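{- Let $n,k,d,m$ be positive integers. Let $A(n,k,d,m)$ be the set of integer partitions of $n$ in which exactly $k$ parts are divisible by $d$ and all other parts (i.e. the parts not divisible by $d$) are strictly less than $md$. Let $B(n,k,d,m)$ be the set of integer partitions of $n$ such that: (i) if $m<k$: the largest part is $kd$, and all parts greater than $md$ are divisible by $d$; (ii) if $m\ge k$: the part $k$ occurs at least $d$ times, no part exceeds $md$, and every part $i$ with $k<i\le m$ occurs fewer than $d$ times. Then $|A(n,k,d,m)| = |B(n,k,d,m)|$.
   Context: A partition of $n$ is a finite multiset of positive integers (parts) summing to $n$; parts are counted with multiplicity, so "exactly $k$ parts are divisible by $d$" counts repeated parts each time they occur. -}

module Defs where

open import Data.Nat using (ℕ; zero; suc; _+_; _*_; _≤_; _<_; _≥_; _≤?_; _<?_; _≟_)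
open import Data.Nat.Divisibility using (_∣_; _∣?_)
open import Data.List using (List; []; _∷_; length; filter; head)
open import Data.Nat.ListAction using (sum)
open import Data.List.Relation.Unary.All using (All)
open import Data.List.Relation.Unary.Linked using (Linked)
open import Data.Maybe using (just)
open import Data.Product using (Σ; _×_)
open import Data.Sum using (_⊎_)
open import Relation.Binary.PropositionalEquality using (_≡_)
open import Relation.Nullary.Decidable using (True; _⊎-dec_)

-- A partition of n: a weakly decreasing list of positive integers summing to n.
-- (All components are proof-irrelevant, so elements of Partition n correspond
--  exactly to partitions of n.)
IsPartition : ℕ → List ℕ → Set
IsPartition n ps = Linked _≥_ ps × All (λ x → 0 < x) ps × sum ps ≡ n

numDivBy : ℕ → List ℕ → ℕ
numDivBy d ps = length (filter (d ∣?_) ps)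

mult : ℕ → List ℕ → ℕ
mult i ps = length (filter (_≟ i) ps)

CondA : ℕ → ℕ → ℕ → List ℕ → Set
CondA k d m ps =
  numDivBy d ps ≡ k × All (λ x → True ((d ∣? x) ⊎-dec (x <? m * d))) ps

CondBi : ℕ → ℕ → ℕ → List ℕ → Set
CondBi k d m ps =
  head ps ≡ just (k * d) × All (λ x → True ((x ≤? m * d) ⊎-dec (d ∣? x))) ps

CondBii : ℕ → ℕ → ℕ → List ℕ → Set
CondBii k d m ps =
  d ≤ mult k ps
  × All (λ x → x ≤ m * d) ps
  × All (λ i → True ((i ≤? k) ⊎-dec (m <? i) ⊎-dec (mult i ps <? d))) ps

CondB : ℕ → ℕ → ℕ → List ℕ → Set
CondB k d m ps = (m < k × CondBi k d m ps) ⊎ (k ≤ m × CondBii k d m ps)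

A : ℕ → ℕ → ℕ → ℕ → Set
A n k d m = Σ (List ℕ) (λ ps → IsPartition n ps × CondA k d m ps)

B : ℕ → ℕ → ℕ → ℕ → Set
B n k d m = Σ (List ℕ) (λ ps → IsPartition n ps × CondB k d m ps)

-- Split a partition into the partition α of its parts not divisible by d and the partition ν of the
-- quotients by d of its other parts. For A(n,k,d,m), α has parts below md and ν has exactly k parts;
-- conjugating ν gives a partition μ with largest part k. If m < k, reassembling α with dμ gives exactly
-- the partitions in B: the largest part is kd and the parts above md are multiples of d. If m ≥ k, remove
-- d copies of k from a partition in B and apply Glaisher's exchange (d parts j ↔ one part jd) for
-- j = m, m-1, …, k+1, which turns "j occurs fewer than d times" into "jd does not occur". The multiples
-- of d then have quotients at most k, and adding a part k to these quotients gives a partition μ with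
-- largest part k.
module Submission where

open import Defs
open import Data.Nat
open import Data.Nat.Properties
open import Data.List using (List; []; _∷_; length; filter; head; map; replicate; _++_; applyUpTo; _∷ʳ_; drop)
open import Data.List.Properties using (filter-accept; filter-reject; length-++; filter-++; length-applyUpTo; applyUpTo-∷ʳ; map-∘; map-id-local; length-map)
open import Data.Nat.ListAction using (sum)
open import Data.Nat.ListAction.Properties using (sum-++)
open import Data.List.Relation.Unary.All as All using (All; []; _∷_)
open import Data.List.Relation.Unary.All.Properties as All using (++⁺; replicate⁺)
open import Data.List.Relation.Unary.Linked as Linked using (Linked; []; [-]; _∷_)
open import Data.List.Relation.Unary.Linked.Properties as Linked using (Linked⇒All)
open import Data.List.Membership.Propositional using (_∈_)
open import Data.List.Membership.Propositional.Properties using (∈-map⁺; ∈-filter⁻)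
open import Data.List.Relation.Unary.Any using (here; there)
open import Data.Bool.Properties using (T-irrelevant)
open import Data.Maybe using (just)
import Data.Maybe.Properties as Maybe
open import Axiom.UniquenessOfIdentityProofs using (module Decidable⇒UIP)
open import Function.Bundles using (_↔_; mk↔ₛ′)
open import Function.Properties.Inverse using (↔-refl; ↔-sym; ↔-trans)
open import Function.Related.Propositional using (bijection)
open import Data.Product.Function.Dependent.Propositional using (congˡ)
open import Data.Product using (Σ; _×_; _,_; proj₁; proj₂)
open import Data.Sum using (_⊎_; inj₁; inj₂)
open import Function using (flip; _∘_; id)
open import Relation.Nullary using (¬_; yes; no; contradiction; Irrelevant)
open import Relation.Nullary.Decidable using (True; False; toWitness; fromWitness; toWitnessFalse; fromWitnessFalse; _⊎-dec_)
open import Relation.Unary using (Decidable; ∁)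
open import Relation.Unary.Properties using (∁?)
open import Relation.Binary.PropositionalEquality
open import Relation.Binary.Definitions using (tri<; tri≈; tri>)
open import Data.Nat.Solver using (module +-*-Solver)
open import Data.Nat.DivMod
  using (_/_; _%_; m%n<n; m≡m%n+[m/n]*n; [m+kn]%n≡m%n; m<n⇒m%n≡m; +-distrib-/-∣ʳ; m<n⇒m/n≡0; m*n/n≡m; m/n*n≡m; /-monoˡ-≤; m≥n⇒m/n>0)
open import Data.Nat.Divisibility using (_∣_; _∣?_; divides; ∣⇒≤)

-- Multiplicities

Descending : List ℕ → Set
Descending = Linked _≥_

Positive : List ℕ → Set
Positive = All (0 <_)

InRange : ℕ → ℕ → Set
InRange L x = 0 < x × x ≤ L

≤-head : ∀ {x xs} → Descending (x ∷ xs) → All (_≤ x) (x ∷ xs)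
≤-head = Linked⇒All (flip ≤-trans) ≤-refl

head-≥ : ∀ {xs : List ℕ} {x} → Descending xs → head xs ≡ just x → All (_≤ x) xs
head-≥ {_ ∷ _} dxs refl = ≤-head dxs

head-max : ∀ {xs x} → Descending xs → x ∈ xs → All (_≤ x) xs → head xs ≡ just x
head-max _ (here refl) _ = refl
head-max dxs (there x∈) (y≤x ∷ _) = cong just (≤-antisym y≤x (All.lookup (All.tail (≤-head dxs)) x∈))

head-∈ : ∀ (xs : List ℕ) {x} → head xs ≡ just x → x ∈ xs
head-∈ (_ ∷ _) refl = here refl

mult-∷-≡ : ∀ {p x} xs → x ≡ p → mult p (x ∷ xs) ≡ suc (mult p xs)
mult-∷-≡ {p} xs x≡p = cong length (filter-accept (_≟ p) x≡p)

mult-∷-≢ : ∀ {p x} xs → x ≢ p → mult p (x ∷ xs) ≡ mult p xs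
mult-∷-≢ {p} xs x≢p = cong length (filter-reject (_≟ p) x≢p)

mult-head : ∀ x xs → mult x (x ∷ xs) ≡ suc (mult x xs)
mult-head x xs = mult-∷-≡ xs refl

mult≡0 : ∀ {p} xs → All (_≢ p) xs → mult p xs ≡ 0
mult≡0 [] [] = refl
mult≡0 (x ∷ xs) (x≢p ∷ h) = trans (mult-∷-≢ xs x≢p) (mult≡0 xs h)

mult≡0-above : ∀ {x y} xs → All (_≤ x) xs → x < y → mult y xs ≡ 0
mult≡0-above xs xs≤x x<y = mult≡0 xs (All.map (λ z≤x z≡y → <-irrefl z≡y (≤-<-trans z≤x x<y)) xs≤x)

mult-++ : ∀ p xs ys → mult p (xs ++ ys) ≡ mult p xs + mult p ys
mult-++ p xs ys = trans (cong length (filter-++ (_≟ p) xs ys)) (length-++ (filter (_≟ p) xs))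

mult-replicate : ∀ c x → mult x (replicate c x) ≡ c
mult-replicate zero x = refl
mult-replicate (suc c) x = trans (mult-head x (replicate c x)) (cong suc (mult-replicate c x))

mult-replicate-≢ : ∀ {p} c x → x ≢ p → mult p (replicate c x) ≡ 0
mult-replicate-≢ c x x≢p = mult≡0 _ (replicate⁺ c x≢p)

∈⇒mult>0 : ∀ {p xs} → p ∈ xs → 0 < mult p xs
∈⇒mult>0 {p} {x ∷ xs} (here p≡x) = subst (0 <_) (sym (mult-∷-≡ xs (sym p≡x))) z<s
∈⇒mult>0 {p} {x ∷ xs} (there p∈xs) with x ≟ p
... | yes x≡p = subst (0 <_) (sym (mult-∷-≡ xs x≡p)) z<s
... | no x≢p = subst (0 <_) (sym (mult-∷-≢ xs x≢p)) (∈⇒mult>0 p∈xs)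

mult>0⇒∈ : ∀ {p} xs → 0 < mult p xs → p ∈ xs
mult>0⇒∈ {p} (x ∷ xs) h with x ≟ p
... | yes x≡p = here (sym x≡p)
... | no x≢p = there (mult>0⇒∈ xs (subst (0 <_) (mult-∷-≢ xs x≢p) h))

mult-cancel-∷ : ∀ {p} x xs ys → mult p (x ∷ xs) ≡ mult p (x ∷ ys) → mult p xs ≡ mult p ys
mult-cancel-∷ {p} x xs ys eq with x ≟ p
... | yes x≡p = suc-injective (trans (sym (mult-∷-≡ xs x≡p)) (trans eq (mult-∷-≡ ys x≡p)))
... | no x≢p = trans (sym (mult-∷-≢ xs x≢p)) (trans eq (mult-∷-≢ ys x≢p))

mult-∷-cong : ∀ {p} x {xs ys} → mult p xs ≡ mult p ys → mult p (x ∷ xs) ≡ mult p (x ∷ ys)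
mult-∷-cong {p} x {xs} {ys} eq with x ≟ p
... | yes x≡p = trans (mult-∷-≡ xs x≡p) (trans (cong suc eq) (sym (mult-∷-≡ ys x≡p)))
... | no x≢p = trans (mult-∷-≢ xs x≢p) (trans eq (sym (mult-∷-≢ ys x≢p)))

mult-head≢0 : ∀ x xs → mult x (x ∷ xs) ≢ 0
mult-head≢0 x xs eq = 0≢1+n (trans (sym eq) (mult-head x xs))

descending-≡ : ∀ xs ys → Descending xs → Descending ys → (∀ p → mult p xs ≡ mult p ys) → xs ≡ ys
descending-≡ [] [] _ _ _ = refl
descending-≡ [] (y ∷ ys) _ _ eq = contradiction (sym (eq y)) (mult-head≢0 y ys)
descending-≡ (x ∷ xs) [] _ _ eq = contradiction (eq x) (mult-head≢0 x xs)
descending-≡ (x ∷ xs) (y ∷ ys) dx dy eq with <-cmp x y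
... | tri< x<y _ _ = contradiction (trans (sym (eq y)) (mult≡0-above (x ∷ xs) (≤-head dx) x<y)) (mult-head≢0 y ys)
... | tri> _ _ y<x = contradiction (trans (eq x) (mult≡0-above (y ∷ ys) (≤-head dy) y<x)) (mult-head≢0 x xs)
... | tri≈ _ refl _ =
  cong (x ∷_) (descending-≡ xs ys (Linked.tail dx) (Linked.tail dy) (λ p → mult-cancel-∷ x xs ys (eq p)))

∷-descending : ∀ {x} ys → Descending ys → All (_≤ x) ys → Descending (x ∷ ys)
∷-descending [] _ _ = [-]
∷-descending (y ∷ ys) d (y≤x ∷ _) = y≤x ∷ d

replicate-++-descending : ∀ c x ys → Descending ys → All (_≤ x) ys → Descending (replicate c x ++ ys)
replicate-++-descending zero x ys d ys≤x = d
replicate-++-descending (suc c) x ys d ys≤x =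
  ∷-descending _ (replicate-++-descending c x ys d ys≤x) (++⁺ (replicate⁺ c ≤-refl) ys≤x)

-- Partitions built from multiplicities

fromMult : ℕ → (ℕ → ℕ) → List ℕ
fromMult zero f = []
fromMult (suc L) f = replicate (f (suc L)) (suc L) ++ fromMult L f

fromMult-inRange : ∀ L f → All (InRange L) (fromMult L f)
fromMult-inRange zero f = []
fromMult-inRange (suc L) f =
  ++⁺ (replicate⁺ (f (suc L)) (z<s , ≤-refl)) (All.map (λ (0<x , x≤L) → 0<x , m≤n⇒m≤1+n x≤L) (fromMult-inRange L f))

fromMult-descending : ∀ L f → Descending (fromMult L f)
fromMult-descending zero f = []
fromMult-descending (suc L) f = replicate-++-descending _ _ _ (fromMult-descending L f)
  (All.map (λ (_ , x≤L) → m≤n⇒m≤1+n x≤L) (fromMult-inRange L f))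

mult-outOfRange : ∀ {L p} xs → All (InRange L) xs → p ≡ 0 ⊎ L < p → mult p xs ≡ 0
mult-outOfRange xs h (inj₁ refl) = mult≡0 xs (All.map (λ (0<x , _) x≡0 → <-irrefl (sym x≡0) 0<x) h)
mult-outOfRange xs h (inj₂ L<p) = mult≡0 xs (All.map (λ (_ , x≤L) x≡p → <-irrefl x≡p (≤-<-trans x≤L L<p)) h)

mult-fromMult : ∀ L f p → 0 < p → p ≤ L → mult p (fromMult L f) ≡ f p
mult-fromMult zero f (suc p) 0<p ()
mult-fromMult (suc L) f p 0<p p≤1+L with p ≟ suc L
... | yes refl = begin
  mult p (replicate (f p) p ++ fromMult L f)          ≡⟨ mult-++ p (replicate (f p) p) (fromMult L f) ⟩
  mult p (replicate (f p) p) + mult p (fromMult L f)  ≡⟨ cong₂ _+_ (mult-replicate (f p) p)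
                                                                  (mult-outOfRange _ (fromMult-inRange L f) (inj₂ ≤-refl)) ⟩
  f p + 0                                             ≡⟨ +-identityʳ (f p) ⟩
  f p                                                 ∎
  where open ≡-Reasoning
... | no p≢1+L = begin
  mult p (replicate c (suc L) ++ fromMult L f)          ≡⟨ mult-++ p (replicate c (suc L)) (fromMult L f) ⟩
  mult p (replicate c (suc L)) + mult p (fromMult L f)  ≡⟨ cong₂ _+_ (mult-replicate-≢ c (suc L) (p≢1+L ∘ sym))
                                                                    (mult-fromMult L f p 0<p (≤-pred (≤∧≢⇒< p≤1+L p≢1+L))) ⟩
  f p                                                   ∎
  where
  open ≡-Reasoning
  c = f (suc L)

mult-fromMult-agree : ∀ L f xs → All (InRange L) xs →
  ∀ p → (0 < p → p ≤ L → f p ≡ mult p xs) → mult p (fromMult L f) ≡ mult p xs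
mult-fromMult-agree L f xs h p agree with p ≟ 0 | L <? p
... | yes p≡0 | _ = trans (mult-outOfRange _ (fromMult-inRange L f) (inj₁ p≡0)) (sym (mult-outOfRange xs h (inj₁ p≡0)))
... | no _ | yes L<p = trans (mult-outOfRange _ (fromMult-inRange L f) (inj₂ L<p)) (sym (mult-outOfRange xs h (inj₂ L<p)))
... | no p≢0 | no L≮p = trans (mult-fromMult L f p 0<p p≤L) (agree 0<p p≤L)
  where
  0<p = n≢0⇒n>0 p≢0
  p≤L = ≮⇒≥ L≮p

fromMult-unique : ∀ L f xs → Descending xs → All (InRange L) xs →
  (∀ p → 0 < p → p ≤ L → f p ≡ mult p xs) → fromMult L f ≡ xs
fromMult-unique L f xs d h agree =
  descending-≡ _ xs (fromMult-descending L f) d (λ p → mult-fromMult-agree L f xs h p (agree p))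

fromMult-mult : ∀ L xs → Descending xs → All (InRange L) xs → fromMult L (λ p → mult p xs) ≡ xs
fromMult-mult L xs d h = fromMult-unique L _ xs d h (λ _ _ _ → refl)

weightSum : ℕ → (ℕ → ℕ) → ℕ
weightSum zero f = 0
weightSum (suc L) f = f (suc L) * suc L + weightSum L f

sum-replicate : ∀ c x → sum (replicate c x) ≡ c * x
sum-replicate zero x = refl
sum-replicate (suc c) x = cong (x +_) (sum-replicate c x)

sum-fromMult : ∀ L f → sum (fromMult L f) ≡ weightSum L f
sum-fromMult zero f = refl
sum-fromMult (suc L) f = trans (sum-++ (replicate (f (suc L)) (suc L)) (fromMult L f))
                               (cong₂ _+_ (sum-replicate (f (suc L)) (suc L)) (sum-fromMult L f))

sum≡weightSum-mult : ∀ L xs → Descending xs → All (InRange L) xs → sum xs ≡ weightSum L (λ p → mult p xs)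
sum≡weightSum-mult L xs d h = trans (cong sum (sym (fromMult-mult L xs d h))) (sum-fromMult L _)

weightSum-cong : ∀ L f g → (∀ p → 0 < p → p ≤ L → f p ≡ g p) → weightSum L f ≡ weightSum L g
weightSum-cong zero f g eq = refl
weightSum-cong (suc L) f g eq = cong₂ _+_ (cong (_* suc L) (eq (suc L) z<s ≤-refl))
                                          (weightSum-cong L f g (λ p 0<p p≤L → eq p 0<p (m≤n⇒m≤1+n p≤L)))

weightSum-+ : ∀ L f g → weightSum L (λ p → f p + g p) ≡ weightSum L f + weightSum L g
weightSum-+ zero f g = refl
weightSum-+ (suc L) f g =
  trans (cong ((f (suc L) + g (suc L)) * suc L +_) (weightSum-+ L f g))
        (solve 5 (λ a b l s t → (a :+ b) :* l :+ (s :+ t) := (a :* l :+ s) :+ (b :* l :+ t)) refl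
               (f (suc L)) (g (suc L)) (suc L) (weightSum L f) (weightSum L g))
  where open +-*-Solver

update : ℕ → ℕ → (ℕ → ℕ) → ℕ → ℕ
update q v f p with p ≟ q
... | yes _ = v
... | no _ = f p

update-≡ : ∀ q v f → update q v f q ≡ v
update-≡ q v f with q ≟ q
... | yes _ = refl
... | no q≢q = contradiction refl q≢q

update-≢ : ∀ {q p} v f → p ≢ q → update q v f p ≡ f p
update-≢ {q} {p} v f p≢q with p ≟ q
... | yes p≡q = contradiction p≡q p≢q
... | no _ = refl

weightSum-update : ∀ L q v f → 0 < q → q ≤ L → weightSum L (update q v f) + f q * q ≡ weightSum L f + v * q
weightSum-update zero (suc q) v f 0<q ()
weightSum-update (suc L) q v f 0<q q≤1+L with q ≟ suc L
... | yes refl = begin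
  update q v f q * q + weightSum L (update q v f) + f q * q ≡⟨ cong₂ (λ a b → a * q + b + f q * q) (update-≡ q v f) rest ⟩
  v * q + weightSum L f + f q * q                         ≡⟨ solve 3 (λ a b c → a :+ b :+ c := c :+ b :+ a) refl
                                                                     (v * q) (weightSum L f) (f q * q) ⟩
  f q * q + weightSum L f + v * q                         ∎
  where
  open ≡-Reasoning
  open +-*-Solver
  rest : weightSum L (update q v f) ≡ weightSum L f
  rest = weightSum-cong L _ _ (λ p _ p≤L → update-≢ v f (<⇒≢ (s≤s p≤L)))
... | no q≢1+L = begin
  f′ (suc L) * suc L + weightSum L f′ + f q * q      ≡⟨ cong (λ a → a * suc L + weightSum L f′ + f q * q) (update-≢ v f (q≢1+L ∘ sym)) ⟩
  f (suc L) * suc L + weightSum L f′ + f q * q       ≡⟨ +-assoc (f (suc L) * suc L) _ _ ⟩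
  f (suc L) * suc L + (weightSum L f′ + f q * q)     ≡⟨ cong (f (suc L) * suc L +_) (weightSum-update L q v f 0<q q≤L) ⟩
  f (suc L) * suc L + (weightSum L f + v * q)        ≡⟨ +-assoc (f (suc L) * suc L) _ _ ⟨
  f (suc L) * suc L + weightSum L f + v * q          ∎
  where
  open ≡-Reasoning
  f′ = update q v f
  q≤L = ≤-pred (≤∧≢⇒< q≤1+L q≢1+L)

setMult : ℕ → ℕ → ℕ → List ℕ → List ℕ
setMult L q v xs = fromMult L (update q v (λ p → mult p xs))

setMult-descending : ∀ L q v xs → Descending (setMult L q v xs)
setMult-descending L q v xs = fromMult-descending L _

setMult-inRange : ∀ L q v xs → All (InRange L) (setMult L q v xs)
setMult-inRange L q v xs = fromMult-inRange L _

mult-setMult-≡ : ∀ L q v xs → 0 < q → q ≤ L → mult q (setMult L q v xs) ≡ v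
mult-setMult-≡ L q v xs 0<q q≤L = trans (mult-fromMult L _ q 0<q q≤L) (update-≡ q v _)

mult-setMult-≢ : ∀ L q v xs → All (InRange L) xs → ∀ p → p ≢ q → mult p (setMult L q v xs) ≡ mult p xs
mult-setMult-≢ L q v xs h p p≢q = mult-fromMult-agree L _ xs h p (λ _ _ → update-≢ v _ p≢q)

sum-setMult : ∀ L q v xs → Descending xs → All (InRange L) xs → 0 < q → q ≤ L →
  sum (setMult L q v xs) + mult q xs * q ≡ sum xs + v * q
sum-setMult L q v xs d h 0<q q≤L = begin
  sum (setMult L q v xs) + mult q xs * q           ≡⟨ cong (_+ mult q xs * q) (sum-fromMult L _) ⟩
  weightSum L (update q v mults) + mult q xs * q   ≡⟨ weightSum-update L q v mults 0<q q≤L ⟩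
  weightSum L mults + v * q                        ≡⟨ cong (_+ v * q) (sum≡weightSum-mult L xs d h) ⟨
  sum xs + v * q                                   ∎
  where
  open ≡-Reasoning
  mults = λ p → mult p xs

-- Merging and splitting

≤-sum : ∀ xs → All (_≤ sum xs) xs
≤-sum [] = []
≤-sum (x ∷ xs) = m≤m+n x (sum xs) ∷ All.map (λ y≤ → ≤-trans y≤ (m≤n+m (sum xs) x)) (≤-sum xs)

inRange-sum : ∀ {L} xs → Positive xs → sum xs ≤ L → All (InRange L) xs
inRange-sum xs pos bound = All.zipWith (λ (0<x , x≤) → 0<x , ≤-trans x≤ bound) (pos , ≤-sum xs)

-- Multiset union; sum xs + sum ys bounds every part of both lists.
merge : List ℕ → List ℕ → List ℕ
merge xs ys = fromMult (sum xs + sum ys) (λ p → mult p xs + mult p ys)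

module _ {xs ys : List ℕ} (pxs : Positive xs) (pys : Positive ys) where

  private
    L = sum xs + sum ys
    xs-inRange = inRange-sum xs pxs (m≤m+n (sum xs) (sum ys))
    ys-inRange = inRange-sum ys pys (m≤n+m (sum ys) (sum xs))

  mult-merge : ∀ p → mult p (merge xs ys) ≡ mult p xs + mult p ys
  mult-merge p = trans (mult-fromMult-agree L _ (xs ++ ys) (++⁺ xs-inRange ys-inRange) p (λ _ _ → sym (mult-++ p xs ys)))
                       (mult-++ p xs ys)

  sum-merge : Descending xs → Descending ys → sum (merge xs ys) ≡ sum xs + sum ys
  sum-merge dxs dys = begin
    sum (merge xs ys)                                            ≡⟨ sum-fromMult L _ ⟩
    weightSum L (λ p → mult p xs + mult p ys)                    ≡⟨ weightSum-+ L _ _ ⟩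
    weightSum L (λ p → mult p xs) + weightSum L (λ p → mult p ys) ≡⟨ cong₂ _+_ (sum≡weightSum-mult L xs dxs xs-inRange)
                                                                                (sum≡weightSum-mult L ys dys ys-inRange) ⟨
    sum xs + sum ys                                              ∎
    where open ≡-Reasoning

  merge⁺ : ∀ {P : ℕ → Set} → All P xs → All P ys → All P (merge xs ys)
  merge⁺ {P} Pxs Pys = All.tabulate P-merge
    where
    P-merge : ∀ {x} → x ∈ merge xs ys → P x
    P-merge {x} x∈ with mult x xs | mult>0⇒∈ {x} xs | mult x ys | mult>0⇒∈ {x} ys
                      | subst (0 <_) (mult-merge x) (∈⇒mult>0 x∈)
    ... | suc _ | x∈xs | _     | _    | _ = All.lookup Pxs (x∈xs z<s)
    ... | zero  | _    | suc _ | x∈ys | _ = All.lookup Pys (x∈ys z<s)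

merge-descending : ∀ xs ys → Descending (merge xs ys)
merge-descending xs ys = fromMult-descending (sum xs + sum ys) _

merge-positive : ∀ xs ys → Positive (merge xs ys)
merge-positive xs ys = All.map proj₁ (fromMult-inRange (sum xs + sum ys) _)

merge-comm : ∀ {xs ys} (pxs : Positive xs) (pys : Positive ys) → merge xs ys ≡ merge ys xs
merge-comm {xs} {ys} pxs pys = descending-≡ _ _ (merge-descending xs ys) (merge-descending ys xs) λ p → begin
  mult p (merge xs ys)     ≡⟨ mult-merge pxs pys p ⟩
  mult p xs + mult p ys    ≡⟨ +-comm (mult p xs) (mult p ys) ⟩
  mult p ys + mult p xs    ≡⟨ mult-merge pys pxs p ⟨
  mult p (merge ys xs)     ∎
  where open ≡-Reasoning

module _ {P : ℕ → Set} (P? : Decidable P) where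

  mult-filter-accept : ∀ {p} xs → P p → mult p (filter P? xs) ≡ mult p xs
  mult-filter-accept [] _ = refl
  mult-filter-accept {p} (x ∷ xs) Pp with P? x
  ... | yes _ = mult-∷-cong {p} x (mult-filter-accept xs Pp)
  ... | no ¬Px = trans (mult-filter-accept xs Pp) (sym (mult-∷-≢ {p} {x} xs λ { refl → ¬Px Pp }))

  mult-filter-reject : ∀ {p} xs → ¬ P p → mult p (filter P? xs) ≡ 0
  mult-filter-reject [] _ = refl
  mult-filter-reject {p} (x ∷ xs) ¬Pp with P? x
  ... | yes Px = trans (mult-∷-≢ {p} {x} (filter P? xs) λ { refl → ¬Pp Px }) (mult-filter-reject xs ¬Pp)
  ... | no _ = mult-filter-reject xs ¬Pp

  filter-descending : ∀ {xs} → Descending xs → Descending (filter P? xs)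
  filter-descending = Linked.filter⁺ P? (flip ≤-trans)

merge-filter : ∀ {P : ℕ → Set} (P? : Decidable P) xs → Descending xs → Positive xs → merge (filter P? xs) (filter (∁? P?) xs) ≡ xs
merge-filter P? xs d pos = descending-≡ _ xs (merge-descending (filter P? xs) (filter (∁? P?) xs)) d λ p →
  trans (mult-merge (All.filter⁺ P? pos) (All.filter⁺ (∁? P?) pos) p) (split p)
  where
  split : ∀ p → mult p (filter P? xs) + mult p (filter (∁? P?) xs) ≡ mult p xs
  split p with P? p
  ... | yes Pp = trans (cong₂ _+_ (mult-filter-accept P? xs Pp) (mult-filter-reject (∁? P?) xs (λ ¬Pp → ¬Pp Pp)))
                       (+-identityʳ (mult p xs))
  ... | no ¬Pp = cong₂ _+_ (mult-filter-reject P? xs ¬Pp) (mult-filter-accept (∁? P?) xs ¬Pp)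

filter-merge : ∀ {P : ℕ → Set} (P? : Decidable P) {xs ys} → Descending xs → Positive xs → Positive ys →
  All P xs → All (∁ P) ys → filter P? (merge xs ys) ≡ xs
filter-merge P? {xs} {ys} dxs pxs pys Pxs ¬Pys =
  descending-≡ _ xs (filter-descending P? (merge-descending xs ys)) dxs mults
  where
  mults : ∀ p → mult p (filter P? (merge xs ys)) ≡ mult p xs
  mults p with P? p
  ... | yes Pp = begin
    mult p (filter P? (merge xs ys))  ≡⟨ mult-filter-accept P? (merge xs ys) Pp ⟩
    mult p (merge xs ys)              ≡⟨ mult-merge pxs pys p ⟩
    mult p xs + mult p ys             ≡⟨ cong (mult p xs +_) (mult≡0 ys (All.map (λ { ¬Pp refl → ¬Pp Pp }) ¬Pys)) ⟩
    mult p xs + 0                     ≡⟨ +-identityʳ (mult p xs) ⟩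
    mult p xs                         ∎
    where open ≡-Reasoning
  ... | no ¬Pp = trans (mult-filter-reject P? (merge xs ys) ¬Pp) (sym (mult≡0 xs (All.map (λ { Pp refl → ¬Pp Pp }) Pxs)))

filter-∁-merge : ∀ {P : ℕ → Set} (P? : Decidable P) {xs ys} → Descending ys → Positive xs → Positive ys →
  All P xs → All (∁ P) ys → filter (∁? P?) (merge xs ys) ≡ ys
filter-∁-merge P? dys pxs pys Pxs ¬Pys = trans (cong (filter (∁? P?)) (merge-comm pxs pys))
  (filter-merge (∁? P?) dys pys pxs ¬Pys (All.map (λ Px ¬Px → ¬Px Px) Pxs))

-- Conjugation

countAtLeast : ℕ → List ℕ → ℕ
countAtLeast i xs = length (filter (i ≤?_) xs)

countAtLeast-∷-≤ : ∀ {i x} xs → i ≤ x → countAtLeast i (x ∷ xs) ≡ suc (countAtLeast i xs)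
countAtLeast-∷-≤ {i} xs i≤x = cong length (filter-accept (i ≤?_) i≤x)

countAtLeast-∷-≰ : ∀ {i x} xs → i ≰ x → countAtLeast i (x ∷ xs) ≡ countAtLeast i xs
countAtLeast-∷-≰ {i} xs i≰x = cong length (filter-reject (i ≤?_) i≰x)

countAtLeast-split : ∀ p xs → countAtLeast p xs ≡ mult p xs + countAtLeast (suc p) xs
countAtLeast-split p [] = refl
countAtLeast-split p (x ∷ xs) with x ≟ p | p ≤? x
... | yes refl | _ = begin
  countAtLeast x (x ∷ xs)                           ≡⟨ countAtLeast-∷-≤ xs ≤-refl ⟩
  suc (countAtLeast x xs)                           ≡⟨ cong suc (countAtLeast-split x xs) ⟩
  suc (mult x xs) + countAtLeast (suc x) xs         ≡⟨ cong₂ _+_ (mult-head x xs) (countAtLeast-∷-≰ xs (n≮n x)) ⟨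
  mult x (x ∷ xs) + countAtLeast (suc x) (x ∷ xs)   ∎
  where open ≡-Reasoning
... | no x≢p | yes p≤x = begin
  countAtLeast p (x ∷ xs)                           ≡⟨ countAtLeast-∷-≤ xs p≤x ⟩
  suc (countAtLeast p xs)                           ≡⟨ cong suc (countAtLeast-split p xs) ⟩
  suc (mult p xs + countAtLeast (suc p) xs)         ≡⟨ +-suc (mult p xs) _ ⟨
  mult p xs + suc (countAtLeast (suc p) xs)         ≡⟨ cong₂ _+_ (mult-∷-≢ xs x≢p) (countAtLeast-∷-≤ xs (≤∧≢⇒< p≤x (x≢p ∘ sym))) ⟨
  mult p (x ∷ xs) + countAtLeast (suc p) (x ∷ xs)   ∎
  where open ≡-Reasoning
... | no x≢p | no p≰x = begin
  countAtLeast p (x ∷ xs)                           ≡⟨ countAtLeast-∷-≰ xs p≰x ⟩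
  countAtLeast p xs                                 ≡⟨ countAtLeast-split p xs ⟩
  mult p xs + countAtLeast (suc p) xs               ≡⟨ cong₂ _+_ (mult-∷-≢ xs x≢p) (countAtLeast-∷-≰ xs (p≰x ∘ <⇒≤)) ⟨
  mult p (x ∷ xs) + countAtLeast (suc p) (x ∷ xs)   ∎
  where open ≡-Reasoning

countAtLeast-antitone : ∀ p xs → countAtLeast (suc p) xs ≤ countAtLeast p xs
countAtLeast-antitone p xs = subst (countAtLeast (suc p) xs ≤_) (sym (countAtLeast-split p xs)) (m≤n+m _ _)

countAtLeast≡0 : ∀ {i} xs → All (_< i) xs → countAtLeast i xs ≡ 0
countAtLeast≡0 [] [] = refl
countAtLeast≡0 (x ∷ xs) (x<i ∷ h) = trans (countAtLeast-∷-≰ xs (<⇒≱ x<i)) (countAtLeast≡0 xs h)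

countAtLeast-++ : ∀ i xs ys → countAtLeast i (xs ++ ys) ≡ countAtLeast i xs + countAtLeast i ys
countAtLeast-++ i xs ys = trans (cong length (filter-++ (i ≤?_) xs ys)) (length-++ (filter (i ≤?_) xs))

countAtLeast-replicate : ∀ {i x} c → i ≤ x → countAtLeast i (replicate c x) ≡ c
countAtLeast-replicate zero i≤x = refl
countAtLeast-replicate {x = x} (suc c) i≤x =
  trans (countAtLeast-∷-≤ (replicate c x) i≤x) (cong suc (countAtLeast-replicate c i≤x))

countAtLeast>0 : ∀ {i x xs} → x ∈ xs → i ≤ x → 0 < countAtLeast i xs
countAtLeast>0 {i} {xs = y ∷ ys} (here refl) i≤y = subst (0 <_) (sym (countAtLeast-∷-≤ ys i≤y)) z<s
countAtLeast>0 {i} {xs = y ∷ ys} (there x∈ys) i≤x with i ≤? y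
... | yes i≤y = subst (0 <_) (sym (countAtLeast-∷-≤ ys i≤y)) z<s
... | no i≰y = subst (0 <_) (sym (countAtLeast-∷-≰ ys i≰y)) (countAtLeast>0 x∈ys i≤x)

at : List ℕ → ℕ → ℕ
at [] _ = 0
at (x ∷ xs) zero = x
at (x ∷ xs) (suc j) = at xs j

at-≥length : ∀ xs j → length xs ≤ j → at xs j ≡ 0
at-≥length [] j _ = refl
at-≥length (x ∷ xs) (suc j) (s≤s h) = at-≥length xs j h

at-suc-≤ : ∀ {xs} → Descending xs → ∀ j → at xs (suc j) ≤ at xs j
at-suc-≤ [] j = z≤n
at-suc-≤ [-] j = z≤n
at-suc-≤ (x≥y ∷ d) zero = x≥y
at-suc-≤ (x≥y ∷ d) (suc j) = at-suc-≤ d j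

at>0 : ∀ {xs} → Positive xs → ∀ j → j < length xs → 0 < at xs j
at>0 (0<x ∷ _) zero _ = 0<x
at>0 (_ ∷ pos) (suc j) (s≤s j<n) = at>0 pos j j<n

at-applyUpTo : ∀ f n j → j < n → at (applyUpTo f n) j ≡ f j
at-applyUpTo f (suc n) zero _ = refl
at-applyUpTo f (suc n) (suc j) (s≤s j<n) = at-applyUpTo (f ∘ suc) n j j<n

applyUpTo-at : ∀ xs → applyUpTo (at xs) (length xs) ≡ xs
applyUpTo-at [] = refl
applyUpTo-at (x ∷ xs) = cong (x ∷_) (applyUpTo-at xs)

applyUpTo-cong : ∀ (f g : ℕ → ℕ) n → (∀ j → j < n → f j ≡ g j) → applyUpTo f n ≡ applyUpTo g n
applyUpTo-cong f g zero eq = refl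
applyUpTo-cong f g (suc n) eq = cong₂ _∷_ (eq 0 z<s) (applyUpTo-cong (f ∘ suc) (g ∘ suc) n (λ j j<n → eq (suc j) (s≤s j<n)))

-- For a partition μ with parts at most K, counts K μ lists its column lengths, i.e. its conjugate.
-- For a partition λ with K parts, conjugate K λ is its conjugate described by multiplicities:
-- the part p occurs λₚ − λₚ₊₁ times (with at λ 0 = λ₁).
counts : ℕ → List ℕ → List ℕ
counts K xs = applyUpTo (λ j → countAtLeast (suc j) xs) K

differences : (ℕ → ℕ) → ℕ → ℕ
differences a p = a (pred p) ∸ a p

conjugate : ℕ → List ℕ → List ℕ
conjugate K xs = fromMult K (differences (at xs))

length-counts : ∀ K xs → length (counts K xs) ≡ K
length-counts K xs = length-applyUpTo _ K

counts-descending : ∀ K xs → Descending (counts K xs)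
counts-descending K xs = Linked.applyUpTo⁺₂ _ K (λ j → countAtLeast-antitone (suc j) xs)

counts-positive : ∀ {K xs} → K ∈ xs → Positive (counts K xs)
counts-positive {K} K∈xs = All.applyUpTo⁺₁ _ K (λ j<K → countAtLeast>0 K∈xs j<K)

at-counts : ∀ K xs → All (_≤ K) xs → ∀ j → j ≤ K → at (counts K xs) j ≡ countAtLeast (suc j) xs
at-counts K xs xs≤K j j≤K with m≤n⇒m<n∨m≡n j≤K
... | inj₁ j<K = at-applyUpTo _ K j j<K
... | inj₂ refl = trans (at-≥length (counts j xs) j (≤-reflexive (length-applyUpTo _ j)))
                        (sym (countAtLeast≡0 xs (All.map s≤s xs≤K)))

sum-∷ʳ : ∀ xs x → sum (xs ∷ʳ x) ≡ sum xs + x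
sum-∷ʳ xs x = trans (sum-++ xs (x ∷ [])) (cong (sum xs +_) (+-identityʳ x))

-- Abel summation.
sum-counts : ∀ K xs → sum (counts K xs) ≡ weightSum K (λ p → mult p xs) + K * countAtLeast (suc K) xs
sum-counts zero xs = refl
sum-counts (suc K) xs = begin
  sum (counts (suc K) xs)                            ≡⟨ cong sum (applyUpTo-∷ʳ _ K) ⟨
  sum (counts K xs ∷ʳ countAtLeast (suc K) xs)       ≡⟨ sum-∷ʳ (counts K xs) _ ⟩
  sum (counts K xs) + countAtLeast (suc K) xs        ≡⟨ cong (_+ countAtLeast (suc K) xs) (sum-counts K xs) ⟩
  S + K * countAtLeast (suc K) xs + countAtLeast (suc K) xs
                                                     ≡⟨ cong (λ c → S + K * c + c) (countAtLeast-split (suc K) xs) ⟩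
  S + K * (F + C) + (F + C)                          ≡⟨ solve 4 (λ s k f c → s :+ k :* (f :+ c) :+ (f :+ c)
                                                              := f :* (con 1 :+ k) :+ s :+ (con 1 :+ k) :* c) refl S K F C ⟩
  F * suc K + S + suc K * C                          ∎
  where
  open ≡-Reasoning
  open +-*-Solver
  S = weightSum K (λ p → mult p xs)
  F = mult (suc K) xs
  C = countAtLeast (suc (suc K)) xs

sum-counts-inRange : ∀ K xs → Descending xs → All (InRange K) xs → sum (counts K xs) ≡ sum xs
sum-counts-inRange K xs d h = begin
  sum (counts K xs)                                ≡⟨ sum-counts K xs ⟩
  W + K * countAtLeast (suc K) xs                  ≡⟨ cong (λ c → W + K * c) (countAtLeast≡0 xs (All.map (s≤s ∘ proj₂) h)) ⟩
  W + K * 0                                        ≡⟨ cong (W +_) (*-zeroʳ K) ⟩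
  W + 0                                            ≡⟨ +-identityʳ W ⟩
  W                                                ≡⟨ sum≡weightSum-mult K xs d h ⟨
  sum xs                                           ∎
  where
  open ≡-Reasoning
  W = weightSum K (λ p → mult p xs)

conjugate-counts : ∀ K xs → Descending xs → All (InRange K) xs → conjugate K (counts K xs) ≡ xs
conjugate-counts K xs d h = fromMult-unique K _ xs d h differences-counts
  where
  xs≤K = All.map proj₂ h
  differences-counts : ∀ p → 0 < p → p ≤ K → differences (at (counts K xs)) p ≡ mult p xs
  differences-counts (suc j) _ 1+j≤K = begin
    at (counts K xs) j ∸ at (counts K xs) (suc j)
      ≡⟨ cong₂ _∸_ (at-counts K xs xs≤K j (<⇒≤ 1+j≤K)) (at-counts K xs xs≤K (suc j) 1+j≤K) ⟩
    countAtLeast (suc j) xs ∸ countAtLeast (2 + j) xs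
      ≡⟨ cong (_∸ countAtLeast (2 + j) xs) (countAtLeast-split (suc j) xs) ⟩
    mult (suc j) xs + countAtLeast (2 + j) xs ∸ countAtLeast (2 + j) xs
      ≡⟨ m+n∸n≡m (mult (suc j) xs) (countAtLeast (2 + j) xs) ⟩
    mult (suc j) xs
      ∎
    where open ≡-Reasoning

countAtLeast-fromMult-differences : ∀ (a : ℕ → ℕ) → (∀ j → a (suc j) ≤ a j) → ∀ L j → j ≤ L →
  countAtLeast (suc j) (fromMult L (differences a)) + a L ≡ a j
countAtLeast-fromMult-differences a a↓ zero zero z≤n = refl
countAtLeast-fromMult-differences a a↓ (suc L) j j≤1+L with j ≟ suc L
... | yes refl = cong (_+ a j) (countAtLeast≡0 (fromMult j (differences a)) (All.map (s≤s ∘ proj₂) (fromMult-inRange j (differences a))))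
... | no j≢1+L = begin
  countAtLeast (suc j) (replicate g (suc L) ++ rest) + a (suc L)   ≡⟨ cong (_+ a (suc L)) (countAtLeast-++ (suc j) (replicate g (suc L)) rest) ⟩
  countAtLeast (suc j) (replicate g (suc L)) + c + a (suc L)       ≡⟨ cong (λ x → x + c + a (suc L)) (countAtLeast-replicate g (s≤s j≤L)) ⟩
  g + c + a (suc L)                                                ≡⟨ cong (_+ a (suc L)) (+-comm g c) ⟩
  c + g + a (suc L)                                                ≡⟨ +-assoc c g (a (suc L)) ⟩
  c + (g + a (suc L))                                              ≡⟨ cong (c +_) (m∸n+n≡m (a↓ L)) ⟩
  c + a L                                                          ≡⟨ countAtLeast-fromMult-differences a a↓ L j j≤L ⟩
  a j                                                              ∎
  where
  open ≡-Reasoning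
  j≤L = ≤-pred (≤∧≢⇒< j≤1+L j≢1+L)
  g = a L ∸ a (suc L)
  rest = fromMult L (differences a)
  c = countAtLeast (suc j) rest

counts-conjugate : ∀ K xs → Descending xs → length xs ≡ K → counts K (conjugate K xs) ≡ xs
counts-conjugate _ xs d refl = trans (applyUpTo-cong _ (at xs) (length xs) at-counts-conjugate) (applyUpTo-at xs)
  where
  at-counts-conjugate : ∀ j → j < length xs → countAtLeast (suc j) (conjugate (length xs) xs) ≡ at xs j
  at-counts-conjugate j j<K = begin
    c                       ≡⟨ +-identityʳ c ⟨
    c + 0                   ≡⟨ cong (c +_) (at-≥length xs (length xs) ≤-refl) ⟨
    c + at xs (length xs)   ≡⟨ countAtLeast-fromMult-differences (at xs) (at-suc-≤ d) (length xs) j (<⇒≤ j<K) ⟩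
    at xs j                 ∎
    where
    open ≡-Reasoning
    c = countAtLeast (suc j) (conjugate (length xs) xs)

conjugate-descending : ∀ K xs → Descending (conjugate K xs)
conjugate-descending K xs = fromMult-descending K (differences (at xs))

conjugate-inRange : ∀ K xs → All (InRange K) (conjugate K xs)
conjugate-inRange K xs = fromMult-inRange K (differences (at xs))

sum-conjugate : ∀ K xs → Descending xs → length xs ≡ K → sum (conjugate K xs) ≡ sum xs
sum-conjugate K xs d len = trans (sym (sum-counts-inRange K _ (conjugate-descending K xs) (conjugate-inRange K xs)))
                                 (cong sum (counts-conjugate K xs d len))

head-replicate-++ : ∀ c x (ys : List ℕ) → 0 < c → head (replicate c x ++ ys) ≡ just x
head-replicate-++ (suc c) x ys _ = refl

head-conjugate : ∀ K xs → Positive xs → length xs ≡ suc K → head (conjugate (suc K) xs) ≡ just (suc K)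
head-conjugate K xs pos len = head-replicate-++ (differences (at xs) (suc K)) (suc K) _
  (subst (0 <_) (sym (cong (at xs K ∸_) (at-≥length xs (suc K) (≤-reflexive len))))
         (at>0 pos K (≤-reflexive (sym len))))

×-irrelevant : ∀ {A B : Set} → Irrelevant A → Irrelevant B → Irrelevant (A × B)
×-irrelevant irrA irrB (a , b) (a′ , b′) = cong₂ _,_ (irrA a a′) (irrB b b′)

⊎-irrelevant : ∀ {A B : Set} → (A → ¬ B) → Irrelevant A → Irrelevant B → Irrelevant (A ⊎ B)
⊎-irrelevant _ irrA _ (inj₁ a) (inj₁ a′) = cong inj₁ (irrA a a′)
⊎-irrelevant _ _ irrB (inj₂ b) (inj₂ b′) = cong inj₂ (irrB b b′)
⊎-irrelevant A⇒¬B _ _ (inj₁ a) (inj₂ b) = contradiction b (A⇒¬B a)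
⊎-irrelevant A⇒¬B _ _ (inj₂ b) (inj₁ a) = contradiction b (A⇒¬B a)

descending-irrelevant : ∀ {xs} → Irrelevant (Descending xs)
descending-irrelevant = Linked.irrelevant ≤-irrelevant

positive-irrelevant : ∀ {xs} → Irrelevant (Positive xs)
positive-irrelevant = All.irrelevant ≤-irrelevant

head-irrelevant : ∀ {xs : List ℕ} {y} → Irrelevant (head xs ≡ y)
head-irrelevant = Decidable⇒UIP.≡-irrelevant (Maybe.≡-dec _≟_)

subtype-↔ : ∀ {X Y : Set} {P : X → Set} {Q : Y → Set} (f : X → Y) (g : Y → X) →
  (∀ {x} → P x → Q (f x)) → (∀ {y} → Q y → P (g y)) →
  (∀ {x} → P x → g (f x) ≡ x) → (∀ {y} → Q y → f (g y) ≡ y) →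
  (∀ {x} → Irrelevant (P x)) → (∀ {y} → Irrelevant (Q y)) → Σ X P ↔ Σ Y Q
subtype-↔ f g fP gQ gf fg irrP irrQ =
  mk↔ₛ′ (λ (x , p) → f x , fP p) (λ (y , q) → g y , gQ q) (λ (y , q) → ≡-Σ (fg q) irrQ) (λ (x , p) → ≡-Σ (gf p) irrP)
  where
  ≡-Σ : ∀ {Z : Set} {R : Z → Set} {z z′ : Z} {r : R z} {r′ : R z′} → z ≡ z′ → (∀ {z} → Irrelevant (R z)) → (z , r) ≡ (z′ , r′)
  ≡-Σ refl irr = cong (_ ,_) (irr _ _)

subtype-cong : ∀ {X : Set} {P Q : X → Set} → (∀ {x} → P x → Q x) → (∀ {x} → Q x → P x) →
  (∀ {x} → Irrelevant (P x)) → (∀ {x} → Irrelevant (Q x)) → Σ X P ↔ Σ X Q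
subtype-cong to from = subtype-↔ id id to from (λ _ → refl) (λ _ → refl)

Parts : List ℕ → Set
Parts xs = Descending xs × Positive xs

parts-irrelevant : ∀ {xs} → Irrelevant (Parts xs)
parts-irrelevant = ×-irrelevant descending-irrelevant positive-irrelevant

IsPartitionWith : (ℕ → Set) → List ℕ → Set
IsPartitionWith Q ps = Descending ps × Positive ps × Q (sum ps)

PartitionsWith : (ℕ → Set) → (List ℕ → Set) → Set
PartitionsWith Q C = Σ (List ℕ) (λ ps → IsPartitionWith Q ps × C ps)

isPartitionWith-irrelevant : ∀ {Q : ℕ → Set} → (∀ {s} → Irrelevant (Q s)) → ∀ {ps} → Irrelevant (IsPartitionWith Q ps)
isPartitionWith-irrelevant irrQ = ×-irrelevant descending-irrelevant (×-irrelevant positive-irrelevant irrQ)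

-- Removing copies of a part, and Glaisher's exchange

setMult-isPartitionWith : ∀ {Q : ℕ → Set} L q v xs → Q (sum (setMult L q v xs)) → IsPartitionWith Q (setMult L q v xs)
setMult-isPartitionWith L q v xs Qs = setMult-descending L q v xs , All.map proj₁ (setMult-inRange L q v xs) , Qs

module _ {L q : ℕ} (0<q : 0 < q) (q≤L : q ≤ L) (c : ℕ) {Q : ℕ → Set} {P : List ℕ → Set}
         (irrQ : ∀ {s} → Irrelevant (Q s)) (irrP : ∀ {xs} → Irrelevant (P xs))
         (P-invariant : ∀ {xs ys} → (∀ p → p ≢ q → mult p xs ≡ mult p ys) → P xs → P ys) where

  private
    WithCopies Without : List ℕ → Set
    WithCopies ps = IsPartitionWith Q ps × All (_≤ L) ps × c ≤ mult q ps × P ps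
    Without ps = IsPartitionWith (λ s → Q (s + q * c)) ps × All (_≤ L) ps × P ps

    remove add : List ℕ → List ℕ
    remove ps = setMult L q (mult q ps ∸ c) ps
    add ps = setMult L q (mult q ps + c) ps

    sum-remove : ∀ {ps} → Descending ps → All (InRange L) ps → c ≤ mult q ps → sum (remove ps) + q * c ≡ sum ps
    sum-remove {ps} dps h c≤ = +-cancelʳ-≡ (r * q) _ _ (begin
      sum (remove ps) + q * c + r * q  ≡⟨ solve 4 (λ s c r q → s :+ q :* c :+ r :* q := s :+ (r :+ c) :* q) refl (sum (remove ps)) c r q ⟩
      sum (remove ps) + (r + c) * q    ≡⟨ cong (λ x → sum (remove ps) + x * q) (m∸n+n≡m c≤) ⟩
      sum (remove ps) + mult q ps * q  ≡⟨ sum-setMult L q r ps dps h 0<q q≤L ⟩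
      sum ps + r * q                   ∎)
      where
      open ≡-Reasoning
      open +-*-Solver
      r = mult q ps ∸ c

    sum-add : ∀ {ps} → Descending ps → All (InRange L) ps → sum (add ps) ≡ sum ps + q * c
    sum-add {ps} dps h = +-cancelʳ-≡ (mult q ps * q) _ _ (begin
      sum (add ps) + mult q ps * q     ≡⟨ sum-setMult L q (mult q ps + c) ps dps h 0<q q≤L ⟩
      sum ps + (mult q ps + c) * q     ≡⟨ solve 4 (λ s m c q → s :+ (m :+ c) :* q := s :+ q :* c :+ m :* q) refl (sum ps) (mult q ps) c q ⟩
      sum ps + q * c + mult q ps * q   ∎)
      where
      open ≡-Reasoning
      open +-*-Solver

    remove-without : ∀ {ps} → WithCopies ps → Without (remove ps)
    remove-without {ps} ((dps , pos , Qs) , ≤L , c≤ , Pps) =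
      setMult-isPartitionWith {Q = λ s → Q (s + q * c)} L q _ ps (subst Q (sym (sum-remove dps h c≤)) Qs) ,
      All.map proj₂ (setMult-inRange L q _ ps) ,
      P-invariant (λ p p≢q → sym (mult-setMult-≢ L q _ ps h p p≢q)) Pps
      where h = All.zip (pos , ≤L)

    add-withCopies : ∀ {ps} → Without ps → WithCopies (add ps)
    add-withCopies {ps} ((dps , pos , Qs) , ≤L , Pps) =
      setMult-isPartitionWith {Q = Q} L q _ ps (subst Q (sym (sum-add dps h)) Qs) ,
      All.map proj₂ (setMult-inRange L q _ ps) ,
      subst (c ≤_) (sym (mult-setMult-≡ L q _ ps 0<q q≤L)) (m≤n+m c _) ,
      P-invariant (λ p p≢q → sym (mult-setMult-≢ L q _ ps h p p≢q)) Pps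
      where h = All.zip (pos , ≤L)

    add-remove : ∀ {ps} → WithCopies ps → add (remove ps) ≡ ps
    add-remove {ps} ((dps , pos , _) , ≤L , c≤ , _) = descending-≡ (add (remove ps)) ps (setMult-descending L q _ (remove ps)) dps mults
      where
      mults : ∀ p → mult p (add (remove ps)) ≡ mult p ps
      mults p with p ≟ q
      ... | yes refl = begin
        mult q (add (remove ps))    ≡⟨ mult-setMult-≡ L q _ (remove ps) 0<q q≤L ⟩
        mult q (remove ps) + c      ≡⟨ cong (_+ c) (mult-setMult-≡ L q _ ps 0<q q≤L) ⟩
        mult q ps ∸ c + c           ≡⟨ m∸n+n≡m c≤ ⟩
        mult q ps                   ∎
        where open ≡-Reasoning
      ... | no p≢q = trans (mult-setMult-≢ L q _ (remove ps) (setMult-inRange L q _ ps) p p≢q)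
                           (mult-setMult-≢ L q _ ps (All.zip (pos , ≤L)) p p≢q)

    remove-add : ∀ {ps} → Without ps → remove (add ps) ≡ ps
    remove-add {ps} ((dps , pos , _) , ≤L , _) = descending-≡ (remove (add ps)) ps (setMult-descending L q _ (add ps)) dps mults
      where
      mults : ∀ p → mult p (remove (add ps)) ≡ mult p ps
      mults p with p ≟ q
      ... | yes refl = begin
        mult q (remove (add ps))    ≡⟨ mult-setMult-≡ L q _ (add ps) 0<q q≤L ⟩
        mult q (add ps) ∸ c         ≡⟨ cong (_∸ c) (mult-setMult-≡ L q _ ps 0<q q≤L) ⟩
        mult q ps + c ∸ c           ≡⟨ m+n∸n≡m (mult q ps) c ⟩
        mult q ps                   ∎
        where open ≡-Reasoning
      ... | no p≢q = trans (mult-setMult-≢ L q _ (add ps) (setMult-inRange L q _ ps) p p≢q)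
                           (mult-setMult-≢ L q _ ps (All.zip (pos , ≤L)) p p≢q)

  removeCopies-↔ : PartitionsWith Q (λ ps → All (_≤ L) ps × c ≤ mult q ps × P ps) ↔
                   PartitionsWith (λ s → Q (s + q * c)) (λ ps → All (_≤ L) ps × P ps)
  removeCopies-↔ = subtype-↔ remove add remove-without add-withCopies add-remove remove-add
    (×-irrelevant (isPartitionWith-irrelevant {Q = Q} irrQ) (×-irrelevant (All.irrelevant ≤-irrelevant) (×-irrelevant ≤-irrelevant irrP)))
    (×-irrelevant (isPartitionWith-irrelevant {Q = λ s → Q (s + q * c)} irrQ) (×-irrelevant (All.irrelevant ≤-irrelevant) irrP))

module _ {L q : ℕ} (d : ℕ) .{{_ : NonZero d}} (0<q : 0 < q) (qd≤L : q * d ≤ L) {Q : ℕ → Set} {P : List ℕ → Set}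
         (irrQ : ∀ {s} → Irrelevant (Q s)) (irrP : ∀ {xs} → Irrelevant (P xs))
         (P-invariant : ∀ {xs ys} → (∀ p → p ≢ q → p ≢ q * d → mult p xs ≡ mult p ys) → P xs → P ys) where

  private
    qd = q * d
    q≤qd = m≤m*n q d
    q≤L = ≤-trans q≤qd qd≤L
    0<qd = <-≤-trans 0<q q≤qd

    FewQ NoQD : List ℕ → Set
    FewQ ps = IsPartitionWith Q ps × All (_≤ L) ps × mult q ps < d × P ps
    NoQD ps = IsPartitionWith Q ps × All (_≤ L) ps × mult qd ps ≡ 0 × P ps

    fewQ-irrelevant : ∀ {ps} → Irrelevant (FewQ ps)
    fewQ-irrelevant = ×-irrelevant (isPartitionWith-irrelevant {Q = Q} irrQ)
      (×-irrelevant (All.irrelevant ≤-irrelevant) (×-irrelevant ≤-irrelevant irrP))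

    noQD-irrelevant : ∀ {ps} → Irrelevant (NoQD ps)
    noQD-irrelevant = ×-irrelevant (isPartitionWith-irrelevant {Q = Q} irrQ)
      (×-irrelevant (All.irrelevant ≤-irrelevant) (×-irrelevant ≡-irrelevant irrP))

    -- For d = 1 both sides say that q does not occur.
    glaisher-trivial : d ≡ 1 → Σ (List ℕ) FewQ ↔ Σ (List ℕ) NoQD
    glaisher-trivial d≡1 = subtype-cong to from fewQ-irrelevant noQD-irrelevant
      where
      mult-qd : ∀ ps → mult qd ps ≡ mult q ps
      mult-qd ps = cong (λ p → mult p ps) (trans (cong (q *_) d≡1) (*-identityʳ q))
      to : ∀ {ps} → FewQ ps → NoQD ps
      to {ps} (isP , ≤L , few , Pps) = isP , ≤L , trans (mult-qd ps) (n<1⇒n≡0 (subst (mult q ps <_) d≡1 few)) , Pps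
      from : ∀ {ps} → NoQD ps → FewQ ps
      from {ps} (isP , ≤L , none , Pps) = isP , ≤L , subst (_< d) (trans (sym none) (mult-qd ps)) (subst (0 <_) (sym d≡1) z<s) , Pps

    module _ (q≢qd : q ≢ qd) where

      twoPoint : ℕ → ℕ → List ℕ → List ℕ
      twoPoint v w ps = setMult L q v (setMult L qd w ps)

      twoPoint-descending : ∀ v w ps → Descending (twoPoint v w ps)
      twoPoint-descending v w ps = setMult-descending L q v (setMult L qd w ps)

      twoPoint-inRange : ∀ v w ps → All (InRange L) (twoPoint v w ps)
      twoPoint-inRange v w ps = setMult-inRange L q v (setMult L qd w ps)

      mult-twoPoint-q : ∀ v w ps → mult q (twoPoint v w ps) ≡ v
      mult-twoPoint-q v w ps = mult-setMult-≡ L q v (setMult L qd w ps) 0<q q≤L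

      mult-twoPoint-qd : ∀ v w ps → mult qd (twoPoint v w ps) ≡ w
      mult-twoPoint-qd v w ps = trans (mult-setMult-≢ L q v _ (setMult-inRange L qd w ps) qd (q≢qd ∘ sym))
                                      (mult-setMult-≡ L qd w ps 0<qd qd≤L)

      mult-twoPoint-≢ : ∀ v w {ps} → All (InRange L) ps → ∀ p → p ≢ q → p ≢ qd → mult p (twoPoint v w ps) ≡ mult p ps
      mult-twoPoint-≢ v w {ps} h p p≢q p≢qd = trans (mult-setMult-≢ L q v _ (setMult-inRange L qd w ps) p p≢q)
                                                    (mult-setMult-≢ L qd w ps h p p≢qd)

      sum-twoPoint : ∀ v w {ps} → Descending ps → All (InRange L) ps →
        v * q + w * qd ≡ mult q ps * q + mult qd ps * qd → sum (twoPoint v w ps) ≡ sum ps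
      sum-twoPoint v w {ps} dps h balance = +-cancelʳ-≡ (c * q + e * qd) _ _ (begin
        sum (twoPoint v w ps) + (c * q + e * qd)    ≡⟨ +-assoc (sum (twoPoint v w ps)) _ _ ⟨
        sum (twoPoint v w ps) + c * q + e * qd      ≡⟨ cong (λ x → sum (twoPoint v w ps) + x * q + e * qd) mult-q-ps₁ ⟨
        sum (twoPoint v w ps) + mult q ps₁ * q + e * qd
                                                    ≡⟨ cong (_+ e * qd) (sum-setMult L q v ps₁ (setMult-descending L qd w ps)
                                                                           (setMult-inRange L qd w ps) 0<q q≤L) ⟩
        sum ps₁ + v * q + e * qd                    ≡⟨ solve 3 (λ a b c → a :+ b :+ c := a :+ c :+ b) refl (sum ps₁) (v * q) (e * qd) ⟩
        sum ps₁ + e * qd + v * q                    ≡⟨ cong (_+ v * q) (sum-setMult L qd w ps dps h 0<qd qd≤L) ⟩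
        sum ps + w * qd + v * q                     ≡⟨ solve 3 (λ a b c → a :+ b :+ c := a :+ (c :+ b)) refl (sum ps) (w * qd) (v * q) ⟩
        sum ps + (v * q + w * qd)                   ≡⟨ cong (sum ps +_) balance ⟩
        sum ps + (c * q + e * qd)                   ∎)
        where
        open ≡-Reasoning
        open +-*-Solver
        c = mult q ps
        e = mult qd ps
        ps₁ = setMult L qd w ps
        mult-q-ps₁ : mult q ps₁ ≡ c
        mult-q-ps₁ = mult-setMult-≢ L qd w ps h q q≢qd

      -- break turns each part qd into d parts q; bundle groups the parts q into as many parts qd as possible.
      break bundle : List ℕ → List ℕ
      break ps = twoPoint (mult q ps + mult qd ps * d) 0 ps
      bundle ps = twoPoint (mult q ps % d) (mult q ps / d) ps

      break-noQD : ∀ {ps} → FewQ ps → NoQD (break ps)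
      break-noQD {ps} ((dps , pos , Qs) , ≤L , _ , Pps) =
        setMult-isPartitionWith {Q = Q} L q _ (setMult L qd 0 ps) (subst Q (sym sum-break) Qs) ,
        All.map proj₂ (twoPoint-inRange _ 0 ps) , mult-twoPoint-qd _ 0 ps ,
        P-invariant (λ p p≢q p≢qd → sym (mult-twoPoint-≢ _ 0 h p p≢q p≢qd)) Pps
        where
        open +-*-Solver
        h = All.zip (pos , ≤L)
        sum-break : sum (break ps) ≡ sum ps
        sum-break = sum-twoPoint _ 0 dps h
          (solve 4 (λ c e d q → (c :+ e :* d) :* q :+ con 0 :* (q :* d) := c :* q :+ e :* (q :* d)) refl (mult q ps) (mult qd ps) d q)

      bundle-fewQ : ∀ {ps} → NoQD ps → FewQ (bundle ps)
      bundle-fewQ {ps} ((dps , pos , Qs) , ≤L , none , Pps) =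
        setMult-isPartitionWith {Q = Q} L q _ (setMult L qd (mult q ps / d) ps) (subst Q (sym sum-bundle) Qs) ,
        All.map proj₂ (twoPoint-inRange _ _ ps) , subst (_< d) (sym (mult-twoPoint-q _ _ ps)) (m%n<n (mult q ps) d) ,
        P-invariant (λ p p≢q p≢qd → sym (mult-twoPoint-≢ _ _ h p p≢q p≢qd)) Pps
        where
        open +-*-Solver
        h = All.zip (pos , ≤L)
        c = mult q ps
        sum-bundle : sum (bundle ps) ≡ sum ps
        sum-bundle = sum-twoPoint _ _ dps h (begin
          c % d * q + c / d * qd             ≡⟨ solve 4 (λ r s d q → r :* q :+ s :* (q :* d) := (r :+ s :* d) :* q :+ con 0 :* (q :* d))
                                                        refl (c % d) (c / d) d q ⟩
          (c % d + c / d * d) * q + 0 * qd   ≡⟨ cong₂ (λ x y → x * q + y * qd) (m≡m%n+[m/n]*n c d) none ⟨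
          c * q + mult qd ps * qd            ∎)
          where open ≡-Reasoning

      bundle-break : ∀ {ps} → FewQ ps → bundle (break ps) ≡ ps
      bundle-break {ps} ((dps , pos , _) , ≤L , few , _) = descending-≡ (bundle (break ps)) ps (twoPoint-descending _ _ (break ps)) dps mults
        where
        c = mult q ps
        e = mult qd ps
        mult-q-break : mult q (break ps) ≡ c + e * d
        mult-q-break = mult-twoPoint-q _ 0 ps
        mults : ∀ p → mult p (bundle (break ps)) ≡ mult p ps
        mults p with p ≟ q | p ≟ qd
        ... | yes refl | _ = begin
          mult q (bundle (break ps))    ≡⟨ mult-twoPoint-q _ _ (break ps) ⟩
          mult q (break ps) % d         ≡⟨ cong (_% d) mult-q-break ⟩
          (c + e * d) % d               ≡⟨ [m+kn]%n≡m%n c e d ⟩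
          c % d                         ≡⟨ m<n⇒m%n≡m few ⟩
          c                             ∎
          where open ≡-Reasoning
        ... | no _ | yes refl = begin
          mult qd (bundle (break ps))   ≡⟨ mult-twoPoint-qd _ _ (break ps) ⟩
          mult q (break ps) / d         ≡⟨ cong (_/ d) mult-q-break ⟩
          (c + e * d) / d               ≡⟨ +-distrib-/-∣ʳ c (divides e refl) ⟩
          c / d + e * d / d             ≡⟨ cong₂ _+_ (m<n⇒m/n≡0 few) (m*n/n≡m e d) ⟩
          e                             ∎
          where open ≡-Reasoning
        ... | no p≢q | no p≢qd = trans (mult-twoPoint-≢ _ _ (twoPoint-inRange _ 0 ps) p p≢q p≢qd)
                                       (mult-twoPoint-≢ _ 0 (All.zip (pos , ≤L)) p p≢q p≢qd)

      break-bundle : ∀ {ps} → NoQD ps → break (bundle ps) ≡ ps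
      break-bundle {ps} ((dps , pos , _) , ≤L , none , _) = descending-≡ (break (bundle ps)) ps (twoPoint-descending _ _ (bundle ps)) dps mults
        where
        c = mult q ps
        mults : ∀ p → mult p (break (bundle ps)) ≡ mult p ps
        mults p with p ≟ q | p ≟ qd
        ... | yes refl | _ = begin
          mult q (break (bundle ps))                     ≡⟨ mult-twoPoint-q _ 0 (bundle ps) ⟩
          mult q (bundle ps) + mult qd (bundle ps) * d   ≡⟨ cong₂ (λ x y → x + y * d) (mult-twoPoint-q _ _ ps) (mult-twoPoint-qd _ _ ps) ⟩
          c % d + c / d * d                              ≡⟨ m≡m%n+[m/n]*n c d ⟨
          c                                              ∎
          where open ≡-Reasoning
        ... | no _ | yes refl = trans (mult-twoPoint-qd _ 0 (bundle ps)) (sym none)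
        ... | no p≢q | no p≢qd = trans (mult-twoPoint-≢ _ 0 (twoPoint-inRange _ _ ps) p p≢q p≢qd)
                                       (mult-twoPoint-≢ _ _ (All.zip (pos , ≤L)) p p≢q p≢qd)

  glaisher-step-↔ : PartitionsWith Q (λ ps → All (_≤ L) ps × mult q ps < d × P ps) ↔
                    PartitionsWith Q (λ ps → All (_≤ L) ps × mult (q * d) ps ≡ 0 × P ps)
  glaisher-step-↔ with d ≟ 1
  ... | yes d≡1 = glaisher-trivial d≡1
  ... | no d≢1 = subtype-↔ (break q≢qd) (bundle q≢qd) (break-noQD q≢qd) (bundle-fewQ q≢qd)
                           (bundle-break q≢qd) (break-bundle q≢qd) fewQ-irrelevant noQD-irrelevant
    where
    q≢qd : q ≢ qd
    q≢qd = <⇒≢ (m<m*n q d {{>-nonZero 0<q}} (≤∧≢⇒< (n≢0⇒n>0 (≢-nonZero⁻¹ d)) (d≢1 ∘ sym)))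

-- Separating the multiples of d

module _ (d : ℕ) .{{_ : NonZero d}} where

  map-/-map-* : ∀ xs → map (_/ d) (map (_* d) xs) ≡ xs
  map-/-map-* xs = trans (sym (map-∘ xs)) (map-id-local (All.universal (λ x → m*n/n≡m x d) xs))

  map-*-map-/ : ∀ {xs} → All (d ∣_) xs → map (_* d) (map (_/ d) xs) ≡ xs
  map-*-map-/ {xs} d∣xs = trans (sym (map-∘ xs)) (map-id-local (All.map m/n*n≡m d∣xs))

  map-*-parts : ∀ {xs} → Parts xs → Parts (map (_* d) xs)
  map-*-parts (dxs , pos) = Linked.map⁺ (Linked.map (*-monoˡ-≤ d) dxs) ,
                            All.map⁺ (All.map (λ 0<x → *-monoˡ-< d 0<x) pos)

  map-/-parts : ∀ {xs} → Parts xs → All (d ∣_) xs → Parts (map (_/ d) xs)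
  map-/-parts (dxs , pos) d∣xs = Linked.map⁺ (Linked.map (/-monoˡ-≤ d) dxs) ,
                                 All.map⁺ (All.zipWith (λ (0<x , d∣x) → m≥n⇒m/n>0 (∣⇒≤ {{>-nonZero 0<x}} d∣x)) (pos , d∣xs))

  map-*-divisible : ∀ xs → All (d ∣_) (map (_* d) xs)
  map-*-divisible xs = All.map⁺ (All.universal (λ x → divides x refl) xs)

  sum-map-* : ∀ xs → sum (map (_* d) xs) ≡ sum xs * d
  sum-map-* [] = refl
  sum-map-* (x ∷ xs) = trans (cong (x * d +_) (sum-map-* xs)) (sym (*-distribʳ-+ d x (sum xs)))

module Decomposition (d : ℕ) .{{_ : NonZero d}} (m : ℕ) where

  -- False rather than ¬, so that the predicate is proof-irrelevant without function extensionality.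
  SmallNonMultiple : ℕ → Set
  SmallNonMultiple x = False (d ∣? x) × x < m * d

  nonMultiples : List ℕ → List ℕ
  nonMultiples = filter (∁? (d ∣?_))

  quotients : List ℕ → List ℕ
  quotients ps = map (_/ d) (filter (d ∣?_) ps)

  assemble : List ℕ → List ℕ → List ℕ
  assemble α ν = merge (map (_* d) ν) α

  -- A partition corresponds to the pair of its non-multiples of d and the quotients of its multiples.
  IsSplit : (ℕ → Set) → (List ℕ → Set) → List ℕ × List ℕ → Set
  IsSplit Q S (α , ν) = ((Parts α × All SmallNonMultiple α) × (Parts ν × S ν)) × Q (sum α + sum ν * d)

  Split : (ℕ → Set) → (List ℕ → Set) → Set
  Split Q S = Σ (List ℕ × List ℕ) (IsSplit Q S)

  isSplit-irrelevant : ∀ {Q : ℕ → Set} {S : List ℕ → Set} → (∀ {s} → Irrelevant (Q s)) → (∀ {xs} → Irrelevant (S xs)) →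
    ∀ {αν} → Irrelevant (IsSplit Q S αν)
  isSplit-irrelevant irrQ irrS {α , ν} = ×-irrelevant
    (×-irrelevant (×-irrelevant parts-irrelevant (All.irrelevant (×-irrelevant T-irrelevant ≤-irrelevant)))
                  (×-irrelevant parts-irrelevant irrS))
    irrQ

  nonMultiple : ∀ {α} → All SmallNonMultiple α → All (∁ (d ∣_)) α
  nonMultiple = All.map (toWitnessFalse ∘ proj₁)

  nonMultiples-parts : ∀ {ps} → Parts ps → Parts (nonMultiples ps)
  nonMultiples-parts (dps , pos) = filter-descending (∁? (d ∣?_)) dps , All.filter⁺ (∁? (d ∣?_)) pos

  quotients-parts : ∀ {ps} → Parts ps → Parts (quotients ps)
  quotients-parts {ps} (dps , pos) =
    map-/-parts d (filter-descending (d ∣?_) dps , All.filter⁺ (d ∣?_) pos) (All.all-filter (d ∣?_) ps)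

  assemble-parts : ∀ α ν → Parts (assemble α ν)
  assemble-parts α ν = merge-descending (map (_* d) ν) α , merge-positive (map (_* d) ν) α

  assemble-decompose : ∀ {ps} → Parts ps → assemble (nonMultiples ps) (quotients ps) ≡ ps
  assemble-decompose {ps} (dps , pos) =
    trans (cong (λ xs → merge xs (nonMultiples ps)) (map-*-map-/ d (All.all-filter (d ∣?_) ps)))
          (merge-filter (d ∣?_) ps dps pos)

  multiples-assemble : ∀ {α ν} → Positive α → Parts ν → All (∁ (d ∣_)) α → filter (d ∣?_) (assemble α ν) ≡ map (_* d) ν
  multiples-assemble {α} {ν} pα pν ∤α =
    filter-merge (d ∣?_) (map-*-parts d pν .proj₁) (map-*-parts d pν .proj₂) pα (map-*-divisible d ν) ∤α

  nonMultiples-assemble : ∀ {α ν} → Parts α → Parts ν → All (∁ (d ∣_)) α → nonMultiples (assemble α ν) ≡ α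
  nonMultiples-assemble {α} {ν} (dα , pα) pν ∤α =
    filter-∁-merge (d ∣?_) dα (map-*-parts d pν .proj₂) pα (map-*-divisible d ν) ∤α

  quotients-assemble : ∀ {α ν} → Positive α → Parts ν → All (∁ (d ∣_)) α → quotients (assemble α ν) ≡ ν
  quotients-assemble {α} {ν} pα pν ∤α = trans (cong (map (_/ d)) (multiples-assemble pα pν ∤α)) (map-/-map-* d ν)

  sum-assemble : ∀ {α ν} → Parts α → Parts ν → sum (assemble α ν) ≡ sum α + sum ν * d
  sum-assemble {α} {ν} (dα , pα) pν = begin
    sum (merge (map (_* d) ν) α)     ≡⟨ sum-merge (map-*-parts d pν .proj₂) pα (map-*-parts d pν .proj₁) dα ⟩
    sum (map (_* d) ν) + sum α       ≡⟨ +-comm (sum (map (_* d) ν)) (sum α) ⟩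
    sum α + sum (map (_* d) ν)       ≡⟨ cong (sum α +_) (sum-map-* d ν) ⟩
    sum α + sum ν * d                ∎
    where open ≡-Reasoning

  sum-decompose : ∀ {ps} → Parts ps → sum (nonMultiples ps) + sum (quotients ps) * d ≡ sum ps
  sum-decompose {ps} pps = trans (sym (sum-assemble (nonMultiples-parts pps) (quotients-parts pps)))
                                 (cong sum (assemble-decompose pps))

  decompose-↔ : ∀ {Q : ℕ → Set} {C S : List ℕ → Set} →
    (∀ {s} → Irrelevant (Q s)) → (∀ {xs} → Irrelevant (C xs)) → (∀ {xs} → Irrelevant (S xs)) →
    (∀ {ps} → Parts ps → C ps → All SmallNonMultiple (nonMultiples ps) × S (quotients ps)) →
    (∀ {α ν} → Parts α → All SmallNonMultiple α → Parts ν → S ν → C (assemble α ν)) →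
    PartitionsWith Q C ↔ Split Q S
  decompose-↔ {Q} {C} {S} irrQ irrC irrS to-C from-S = subtype-↔ (λ ps → nonMultiples ps , quotients ps) (λ (α , ν) → assemble α ν)
    to from (λ ((dps , pos , _) , _) → assemble-decompose (dps , pos)) fg
    (×-irrelevant (isPartitionWith-irrelevant {Q = Q} irrQ) irrC) (isSplit-irrelevant {Q = Q} {S = S} irrQ irrS)
    where
    to : ∀ {ps} → IsPartitionWith Q ps × C ps → IsSplit Q S (nonMultiples ps , quotients ps)
    to {ps} ((dps , pos , Qs) , Cps) = let (small , Sν) = to-C (dps , pos) Cps in
      ((nonMultiples-parts (dps , pos) , small) , (quotients-parts (dps , pos) , Sν)) ,
      subst Q (sym (sum-decompose (dps , pos))) Qs
    from : ∀ {αν} → IsSplit Q S αν → IsPartitionWith Q (assemble (proj₁ αν) (proj₂ αν)) × C (assemble (proj₁ αν) (proj₂ αν))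
    from {α , ν} (((pα , small) , (pν , Sν)) , Qs) =
      (assemble-parts α ν .proj₁ , assemble-parts α ν .proj₂ , subst Q (sym (sum-assemble pα pν)) Qs) ,
      from-S pα small pν Sν
    fg : ∀ {αν} → IsSplit Q S αν →
         (nonMultiples (assemble (proj₁ αν) (proj₂ αν)) , quotients (assemble (proj₁ αν) (proj₂ αν))) ≡ αν
    fg {α , ν} (((pα , small) , (pν , _)) , _) =
      cong₂ _,_ (nonMultiples-assemble pα pν (nonMultiple small)) (quotients-assemble (pα .proj₂) pν (nonMultiple small))

  split-conjugate-↔ : ∀ {Q : ℕ → Set} K → (∀ {s} → Irrelevant (Q s)) →
    Split Q (λ ν → length ν ≡ suc K) ↔ Split Q (λ μ → head μ ≡ just (suc K))
  split-conjugate-↔ {Q} K irrQ = subtype-↔ (λ (α , ν) → α , conjugate (suc K) ν) (λ (α , μ) → α , counts (suc K) μ)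
    to from (λ {αν} → counts-conj {αν}) (λ {αμ} → conj-counts {αμ})
    (isSplit-irrelevant {Q = Q} {S = Length} irrQ ≡-irrelevant) (isSplit-irrelevant {Q = Q} {S = Largest} irrQ head-irrelevant)
    where
    Length Largest : List ℕ → Set
    Length ν = length ν ≡ suc K
    Largest μ = head μ ≡ just (suc K)
    to : ∀ {αν} → IsSplit Q Length αν → IsSplit Q Largest (proj₁ αν , conjugate (suc K) (proj₂ αν))
    to {α , ν} (((pα , small) , ((dν , pν) , len)) , Qs) =
      ((pα , small) , ((conjugate-descending (suc K) ν , All.map proj₁ (conjugate-inRange (suc K) ν)) , head-conjugate K ν pν len)) ,
      subst (λ s → Q (sum α + s * d)) (sym (sum-conjugate (suc K) ν dν len)) Qs
    from : ∀ {αμ} → IsSplit Q Largest αμ → IsSplit Q Length (proj₁ αμ , counts (suc K) (proj₂ αμ))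
    from {α , μ} (((pα , small) , ((dμ , pμ) , hd)) , Qs) =
      ((pα , small) , ((counts-descending (suc K) μ , counts-positive (head-∈ μ hd)) , length-counts (suc K) μ)) ,
      subst (λ s → Q (sum α + s * d)) (sym (sum-counts-inRange (suc K) μ dμ (All.zip (pμ , head-≥ dμ hd)))) Qs
    counts-conj : ∀ {αν} → IsSplit Q Length αν → (proj₁ αν , counts (suc K) (conjugate (suc K) (proj₂ αν))) ≡ αν
    counts-conj {α , ν} ((_ , ((dν , _) , len)) , _) = cong (α ,_) (counts-conjugate (suc K) ν dν len)
    conj-counts : ∀ {αμ} → IsSplit Q Largest αμ → (proj₁ αμ , conjugate (suc K) (counts (suc K) (proj₂ αμ))) ≡ αμ
    conj-counts {α , μ} ((_ , ((dμ , pμ) , hd)) , _) = cong (α ,_) (conjugate-counts (suc K) μ dμ (All.zip (pμ , head-≥ dμ hd)))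

  prependLargest-↔ : ∀ {Q : ℕ → Set} k → 0 < k → (∀ {s} → Irrelevant (Q s)) →
    Split (λ s → Q (s + k * d)) (All (_≤ k)) ↔ Split Q (λ μ → head μ ≡ just k)
  prependLargest-↔ {Q} k 0<k irrQ = subtype-↔ (λ (α , ν) → α , k ∷ ν) (λ (α , μ) → α , drop 1 μ)
    to from (λ _ → refl) (λ {αμ} → prepend-drop {αμ})
    (isSplit-irrelevant {Q = Q′} {S = All (_≤ k)} irrQ (All.irrelevant ≤-irrelevant))
    (isSplit-irrelevant {Q = Q} {S = Largest} irrQ head-irrelevant)
    where
    open +-*-Solver
    Q′ : ℕ → Set
    Q′ s = Q (s + k * d)
    Largest : List ℕ → Set
    Largest μ = head μ ≡ just k
    sum-∷ : ∀ a ν → a + sum (k ∷ ν) * d ≡ a + sum ν * d + k * d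
    sum-∷ a ν = solve 4 (λ a k s d → a :+ (k :+ s) :* d := a :+ s :* d :+ k :* d) refl a k (sum ν) d
    to : ∀ {αν} → IsSplit Q′ (All (_≤ k)) αν → IsSplit Q Largest (proj₁ αν , k ∷ proj₂ αν)
    to {α , ν} ((pα , ((dν , pν) , ν≤k)) , Qs) =
      (pα , ((∷-descending ν dν ν≤k , 0<k ∷ pν) , refl)) , subst Q (sym (sum-∷ (sum α) ν)) Qs
    from : ∀ {αμ} → IsSplit Q Largest αμ → IsSplit Q′ (All (_≤ k)) (proj₁ αμ , drop 1 (proj₂ αμ))
    from {α , x ∷ ν} ((pα , ((dμ , _ ∷ pν) , refl)) , Qs) =
      (pα , ((Linked.tail dμ , pν) , All.tail (≤-head dμ))) , subst Q (sum-∷ (sum α) ν) Qs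
    prepend-drop : ∀ {αμ} → IsSplit Q Largest αμ → (proj₁ αμ , k ∷ drop 1 (proj₂ αμ)) ≡ αμ
    prepend-drop {α , x ∷ ν} ((_ , (_ , refl)) , _) = refl

down : ℕ → ℕ → List ℕ
down a zero = []
down a (suc t) = suc (t + a) ∷ down a t

up : ℕ → ℕ → List ℕ
up b zero = []
up b (suc s) = suc b ∷ up (suc b) s

down-bounds : ∀ a t → All (λ j → a < j × j ≤ t + a) (down a t)
down-bounds a zero = []
down-bounds a (suc t) = (s≤s (m≤n+m a t) , ≤-refl) ∷ All.map (λ (a<j , j≤) → a<j , m≤n⇒m≤1+n j≤) (down-bounds a t)

∈-down : ∀ {a j} t → a < j → j ≤ t + a → j ∈ down a t
∈-down {a} {j} zero a<j j≤a = contradiction a<j (≤⇒≯ j≤a)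
∈-down {a} {j} (suc t) a<j j≤ with j ≟ suc (t + a)
... | yes j≡ = here j≡
... | no j≢ = there (∈-down t a<j (≤-pred (≤∧≢⇒< j≤ j≢)))

up-bounds : ∀ b s → All (λ j → b < j × j ≤ s + b) (up b s)
up-bounds b zero = []
up-bounds b (suc s) = (≤-refl , s≤s (m≤n+m b s)) ∷
  All.map (λ {j} (b<j , j≤) → <-trans (n<1+n b) b<j , subst (j ≤_) (+-suc s b) j≤) (up-bounds (suc b) s)

∈-up : ∀ {b j} s → b < j → j ≤ s + b → j ∈ up b s
∈-up {b} {j} zero b<j j≤b = contradiction b<j (≤⇒≯ j≤b)
∈-up {b} {j} (suc s) b<j j≤ with j ≟ suc b
... | yes j≡ = here j≡
... | no j≢ = there (∈-up s (≤∧≢⇒< b<j (j≢ ∘ sym)) (subst (j ≤_) (sym (+-suc s b)) j≤))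

module Bijections (k d m : ℕ) .{{_ : NonZero d}} (0<k : 0 < k) where

  open Decomposition d m

  condB-irrelevant : ∀ {ps} → Irrelevant (CondB k d m ps)
  condB-irrelevant = ⊎-irrelevant (λ (m<k , _) (k≤m , _) → <⇒≱ m<k k≤m)
    (×-irrelevant ≤-irrelevant (×-irrelevant head-irrelevant (All.irrelevant T-irrelevant)))
    (×-irrelevant ≤-irrelevant (×-irrelevant ≤-irrelevant (×-irrelevant (All.irrelevant ≤-irrelevant) (All.irrelevant T-irrelevant))))

  smallNonMultiple : ∀ {x} → ¬ d ∣ x → x ≤ m * d → SmallNonMultiple x
  smallNonMultiple ∤x x≤md = fromWitnessFalse ∤x , ≤∧≢⇒< x≤md (λ { refl → ∤x (divides m refl) })

  nonMultiples-small : ∀ {R : ℕ → Set} ps → All R ps → (∀ {x} → ¬ d ∣ x → R x → SmallNonMultiple x) →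
    All SmallNonMultiple (nonMultiples ps)
  nonMultiples-small ps Rps small = All.zipWith (λ (∤x , Rx) → small ∤x Rx)
    (All.all-filter (∁? (d ∣?_)) ps , All.filter⁺ (∁? (d ∣?_)) Rps)

  A↔split : ∀ n → A n k d m ↔ Split (_≡ n) (λ ν → length ν ≡ k)
  A↔split n = decompose-↔ {Q = _≡ n} ≡-irrelevant (×-irrelevant ≡-irrelevant (All.irrelevant T-irrelevant)) ≡-irrelevant to from
    where
    to : ∀ {ps} → Parts ps → CondA k d m ps → All SmallNonMultiple (nonMultiples ps) × length (quotients ps) ≡ k
    to {ps} _ (#multiples , ok) = nonMultiples-small ps ok small , trans (length-map (_/ d) (filter (d ∣?_) ps)) #multiples
      where
      small : ∀ {x} → ¬ d ∣ x → True ((d ∣? x) ⊎-dec (x <? m * d)) → SmallNonMultiple x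
      small ∤x t with toWitness t
      ... | inj₁ d∣x = contradiction d∣x ∤x
      ... | inj₂ x<md = fromWitnessFalse ∤x , x<md
    from : ∀ {α ν} → Parts α → All SmallNonMultiple α → Parts ν → length ν ≡ k → CondA k d m (assemble α ν)
    from {α} {ν} (_ , pα) small pν len =
      trans (cong length (multiples-assemble pα pν (nonMultiple small))) (trans (length-map (_* d) ν) len) ,
      merge⁺ (map-*-parts d pν .proj₂) pα
        (All.map (fromWitness ∘ inj₁) (map-*-divisible d ν)) (All.map (fromWitness ∘ inj₂ ∘ proj₂) small)

  Bi↔split : m < k → ∀ n → PartitionsWith (_≡ n) (CondBi k d m) ↔ Split (_≡ n) (λ μ → head μ ≡ just k)
  Bi↔split m<k n = decompose-↔ {Q = _≡ n} ≡-irrelevant (×-irrelevant head-irrelevant (All.irrelevant T-irrelevant)) head-irrelevant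
    to from
    where
    head-quotients : ∀ ps → head ps ≡ just (k * d) → head (quotients ps) ≡ just k
    head-quotients (_ ∷ ps) refl = trans (cong (head ∘ map (_/ d)) (filter-accept (d ∣?_) (divides k refl)))
                                         (cong just (m*n/n≡m k d))
    to : ∀ {ps} → Parts ps → CondBi k d m ps → All SmallNonMultiple (nonMultiples ps) × head (quotients ps) ≡ just k
    to {ps} _ (hd , ok) = nonMultiples-small ps ok small , head-quotients ps hd
      where
      small : ∀ {x} → ¬ d ∣ x → True ((x ≤? m * d) ⊎-dec (d ∣? x)) → SmallNonMultiple x
      small ∤x t with toWitness t
      ... | inj₁ x≤md = smallNonMultiple ∤x x≤md
      ... | inj₂ d∣x = contradiction d∣x ∤x
    from : ∀ {α μ} → Parts α → All SmallNonMultiple α → Parts μ → head μ ≡ just k → CondBi k d m (assemble α μ)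
    from {α} {μ} (_ , pα) small (dμ , pμ) hd = head-max (assemble-parts α μ .proj₁) kd∈ ≤kd ,
      merge⁺ pdμ pα (All.map (fromWitness ∘ inj₂) (map-*-divisible d μ)) (All.map (λ (_ , x<md) → fromWitness (inj₁ (<⇒≤ x<md))) small)
      where
      pdμ = map-*-parts d (dμ , pμ) .proj₂
      kd∈ : k * d ∈ assemble α μ
      kd∈ = mult>0⇒∈ (assemble α μ) (subst (0 <_) (sym (mult-merge pdμ pα (k * d)))
              (≤-trans (∈⇒mult>0 (∈-map⁺ (_* d) (head-∈ μ hd))) (m≤m+n _ _)))
      ≤kd : All (_≤ k * d) (assemble α μ)
      ≤kd = merge⁺ pdμ pα (All.map⁺ (All.map (*-monoˡ-≤ d) (head-≥ dμ hd)))
                          (All.map (λ (_ , x<md) → <⇒≤ (<-≤-trans x<md (*-monoˡ-≤ d (<⇒≤ m<k)))) small)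

  module _ (k≤m : k ≤ m) where

    private
      r = m ∸ k
      L = m * d

    FewCopies NoScaledParts : List ℕ → List ℕ → Set
    FewCopies js ps = All (λ j → mult j ps < d) js
    NoScaledParts js ps = All (λ j → mult (j * d) ps ≡ 0) js

    -- At stage (t, s) the parts k+1, …, k+t occur fewer than d times and no part equals jd for
    -- k+t < j ≤ k+t+s. Removing d copies of k from a partition in B(ii) lands in stage (m−k, 0), and
    -- one Glaisher exchange leads from stage (t+1, s) to (t, s+1).
    Restrictions : ℕ → ℕ → List ℕ → Set
    Restrictions t s ps = FewCopies (down k t) ps × NoScaledParts (up (t + k) s) ps

    restrictions-irrelevant : ∀ {t s ps} → Irrelevant (Restrictions t s ps)
    restrictions-irrelevant = ×-irrelevant (All.irrelevant ≤-irrelevant) (All.irrelevant ≡-irrelevant)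

    Stage : ℕ → ℕ → List ℕ → Set
    Stage t s ps = All (_≤ L) ps × Restrictions t s ps

    Stages : ℕ → ℕ → ℕ → Set
    Stages n t s = PartitionsWith (λ x → x + k * d ≡ n) (Stage t s)

    stage-step-↔ : ∀ n t s → suc (t + k) ≤ m → Stages n (suc t) s ↔ Stages n t (suc s)
    stage-step-↔ n t s q≤m =
      ↔-trans (congˡ {k = bijection} (mk↔ₛ′ (λ { (isP , ≤L , few ∷ fews , zs) → isP , ≤L , few , fews , zs })
                                            (λ (isP , ≤L , few , fews , zs) → isP , ≤L , few ∷ fews , zs)
                                            (λ _ → refl) (λ { (_ , _ , _ ∷ _ , _) → refl })))
      (↔-trans (glaisher-step-↔ d z<s (*-monoˡ-≤ d q≤m) {Q = λ x → x + k * d ≡ n} {P = Others}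
                  ≡-irrelevant (×-irrelevant (All.irrelevant ≤-irrelevant) (All.irrelevant ≡-irrelevant))
                  (λ {xs} {ys} → others-invariant {xs} {ys}))
               (congˡ {k = bijection} (mk↔ₛ′ (λ (isP , ≤L , z , fews , zs) → isP , ≤L , fews , z ∷ zs)
                                             (λ { (isP , ≤L , fews , z ∷ zs) → isP , ≤L , z , fews , zs })
                                             (λ { (_ , _ , _ , _ ∷ _) → refl }) (λ _ → refl))))
      where
      q = suc (t + k)
      Others : List ℕ → Set
      Others ps = FewCopies (down k t) ps × NoScaledParts (up q s) ps
      others-invariant : ∀ {xs ys} → (∀ p → p ≢ q → p ≢ q * d → mult p xs ≡ mult p ys) → Others xs → Others ys
      others-invariant agree (fews , zs) =
        All.zipWith (λ ((_ , j≤) , few) → subst (_< d) (agree _ (<⇒≢ (s≤s j≤)) (<⇒≢ (<-≤-trans (s≤s j≤) (m≤m*n q d)))) few)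
                    (down-bounds k t , fews) ,
        All.zipWith (λ ((q<j , _) , z) → trans (sym (agree _ (>⇒≢ (<-≤-trans q<j (m≤m*n _ d))) (>⇒≢ (*-monoˡ-< d q<j)))) z)
                    (up-bounds q s , zs)

    stages-↔ : ∀ n t s → t + s ≡ r → Stages n t s ↔ Stages n 0 r
    stages-↔ n zero s refl = ↔-refl
    stages-↔ n (suc t) s eq = ↔-trans (stage-step-↔ n t s q≤m) (stages-↔ n t (suc s) (trans (+-suc t s) eq))
      where
      q≤m : suc (t + k) ≤ m
      q≤m = subst (suc (t + k) ≤_) (trans (cong (_+ k) eq) (m∸n+n≡m k≤m)) (+-monoˡ-≤ k (s≤s (m≤m+n t s)))

    condBii⇒restrictions : ∀ {ps} → CondBii k d m ps → All (_≤ L) ps × d ≤ mult k ps × Restrictions r 0 ps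
    condBii⇒restrictions {ps} (d≤ , ≤L , ok) = ≤L , d≤ , All.map fewCopies (down-bounds k r) , []
      where
      fewCopies : ∀ {j} → k < j × j ≤ r + k → mult j ps < d
      fewCopies {j} (k<j , j≤) with mult j ps in eq
      ... | zero = n≢0⇒n>0 (≢-nonZero⁻¹ d)
      ... | suc _ with toWitness (All.lookup ok (mult>0⇒∈ ps (subst (0 <_) (sym eq) z<s)))
      ...   | inj₁ j≤k = contradiction j≤k (<⇒≱ k<j)
      ...   | inj₂ (inj₁ m<j) = contradiction (subst (j ≤_) (m∸n+n≡m k≤m) j≤) (<⇒≱ m<j)
      ...   | inj₂ (inj₂ j<d) = subst (_< d) eq j<d

    restrictions⇒condBii : ∀ {ps} → All (_≤ L) ps × d ≤ mult k ps × Restrictions r 0 ps → CondBii k d m ps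
    restrictions⇒condBii {ps} (≤L , d≤ , few , _) = d≤ , ≤L , All.tabulate (λ {i} _ → fromWitness (classify i))
      where
      classify : ∀ i → i ≤ k ⊎ m < i ⊎ mult i ps < d
      classify i with i ≤? k | m <? i
      ... | yes i≤k | _ = inj₁ i≤k
      ... | no _ | yes m<i = inj₂ (inj₁ m<i)
      ... | no i≰k | no m≮i =
        inj₂ (inj₂ (All.lookup few (∈-down r (≰⇒> i≰k) (subst (i ≤_) (sym (m∸n+n≡m k≤m)) (≮⇒≥ m≮i)))))

    Bii↔stage : ∀ n → PartitionsWith (_≡ n) (CondBii k d m) ↔ Stages n r 0
    Bii↔stage n = ↔-trans
      (subtype-cong (λ (isP , c) → isP , condBii⇒restrictions c) (λ (isP , c) → isP , restrictions⇒condBii c)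
        (×-irrelevant (isPartitionWith-irrelevant {Q = _≡ n} ≡-irrelevant)
                      (×-irrelevant ≤-irrelevant (×-irrelevant (All.irrelevant ≤-irrelevant) (All.irrelevant T-irrelevant))))
        (λ {ps} → ×-irrelevant (isPartitionWith-irrelevant {Q = _≡ n} ≡-irrelevant)
                      (×-irrelevant (All.irrelevant ≤-irrelevant) (×-irrelevant ≤-irrelevant (restrictions-irrelevant {ps = ps})))))
      (removeCopies-↔ 0<k (≤-trans k≤m (m≤m*n m d)) d {Q = _≡ n} {P = Restrictions r 0}
        ≡-irrelevant (λ {ps} → restrictions-irrelevant {ps = ps})
        (λ agree (few , _) → All.zipWith (λ ((k<j , _) , fewⱼ) → subst (_< d) (agree _ (≢-sym (<⇒≢ k<j))) fewⱼ)
                                         (down-bounds k r , few) , []))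

    stage↔split : ∀ n → Stages n 0 r ↔ Split (λ x → x + k * d ≡ n) (All (_≤ k))
    stage↔split n = decompose-↔ {Q = λ x → x + k * d ≡ n} {C = Stage 0 r} {S = All (_≤ k)} ≡-irrelevant
      (λ {ps} → ×-irrelevant (All.irrelevant ≤-irrelevant) (restrictions-irrelevant {ps = ps}))
      (All.irrelevant ≤-irrelevant) to from
      where
      to : ∀ {ps} → Parts ps → Stage 0 r ps → All SmallNonMultiple (nonMultiples ps) × All (_≤ k) (quotients ps)
      to {ps} _ (≤L , _ , zeros) = nonMultiples-small ps ≤L smallNonMultiple , All.map⁺ (All.tabulate quotient≤k)
        where
        quotient≤k : ∀ {x} → x ∈ filter (d ∣?_) ps → x / d ≤ k
        quotient≤k {x} x∈ with ∈-filter⁻ (d ∣?_) x∈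
        ... | x∈ps , d∣x = ≮⇒≥ λ k<j → contradiction (zero-x k<j) (>⇒≢ (∈⇒mult>0 x∈ps))
          where
          j = x / d
          jd≡x : j * d ≡ x
          jd≡x = m/n*n≡m d∣x
          j≤m : j ≤ m
          j≤m = *-cancelʳ-≤ j m d (subst (_≤ m * d) (sym jd≡x) (All.lookup ≤L x∈ps))
          zero-x : k < j → mult x ps ≡ 0
          zero-x k<j = subst (λ y → mult y ps ≡ 0) jd≡x
            (All.lookup zeros (∈-up r k<j (subst (j ≤_) (sym (m∸n+n≡m k≤m)) j≤m)))
      from : ∀ {α ν} → Parts α → All SmallNonMultiple α → Parts ν → All (_≤ k) ν → Stage 0 r (assemble α ν)
      from {α} {ν} (_ , pα) small pν ν≤k =
        merge⁺ pdν pα (All.map⁺ (All.map (λ i≤k → *-monoˡ-≤ d (≤-trans i≤k k≤m)) ν≤k)) (All.map (<⇒≤ ∘ proj₂) small) ,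
        [] , All.map zeroAt (up-bounds k r)
        where
        pdν = map-*-parts d pν .proj₂
        zeroAt : ∀ {j} → k < j × j ≤ r + k → mult (j * d) (assemble α ν) ≡ 0
        zeroAt {j} (k<j , _) = trans (mult-merge pdν pα (j * d)) (cong₂ _+_
          (mult≡0 (map (_* d) ν) (All.map⁺ (All.map (λ i≤k → <⇒≢ (*-monoˡ-< d (≤-<-trans i≤k k<j))) ν≤k)))
          (mult≡0 α (All.map (λ (∤x , _) x≡jd → toWitnessFalse ∤x (subst (d ∣_) (sym x≡jd) (divides j refl))) small)))

  B↔Bi : m < k → ∀ n → B n k d m ↔ PartitionsWith (_≡ n) (CondBi k d m)
  B↔Bi m<k n = subtype-cong
    (λ { (isP , inj₁ (_ , c)) → isP , c ; (_ , inj₂ (k≤m , _)) → contradiction k≤m (<⇒≱ m<k) })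
    (λ (isP , c) → isP , inj₁ (m<k , c))
    (×-irrelevant (isPartitionWith-irrelevant {Q = _≡ n} ≡-irrelevant) condB-irrelevant)
    (×-irrelevant (isPartitionWith-irrelevant {Q = _≡ n} ≡-irrelevant) (×-irrelevant head-irrelevant (All.irrelevant T-irrelevant)))

  B↔Bii : k ≤ m → ∀ n → B n k d m ↔ PartitionsWith (_≡ n) (CondBii k d m)
  B↔Bii k≤m n = subtype-cong
    (λ { (isP , inj₂ (_ , c)) → isP , c ; (_ , inj₁ (m<k , _)) → contradiction k≤m (<⇒≱ m<k) })
    (λ (isP , c) → isP , inj₂ (k≤m , c))
    (×-irrelevant (isPartitionWith-irrelevant {Q = _≡ n} ≡-irrelevant) condB-irrelevant)
    (×-irrelevant (isPartitionWith-irrelevant {Q = _≡ n} ≡-irrelevant)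
                  (×-irrelevant ≤-irrelevant (×-irrelevant (All.irrelevant ≤-irrelevant) (All.irrelevant T-irrelevant))))

  B↔split : ∀ n → B n k d m ↔ Split (_≡ n) (λ μ → head μ ≡ just k)
  B↔split n with m <? k
  ... | yes m<k = ↔-trans (B↔Bi m<k n) (Bi↔split m<k n)
  ... | no m≮k = ↔-trans (B↔Bii k≤m n) (↔-trans (Bii↔stage k≤m n) (↔-trans (stages-↔ k≤m n (m ∸ k) 0 (+-identityʳ _))
                   (↔-trans (stage↔split k≤m n) (prependLargest-↔ {Q = _≡ n} k 0<k ≡-irrelevant))))
    where k≤m = ≮⇒≥ m≮k

theorem2p3 : (n k d m : ℕ) → 0 < n → 0 < k → 0 < d → 0 < m →
    A n k d m ↔ B n k d m
theorem2p3 n (suc k) (suc d) m _ _ _ _ =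
  ↔-trans (A↔split n) (↔-trans (split-conjugate-↔ {Q = _≡ n} k ≡-irrelevant) (↔-sym (B↔split n)))
  where
  open Bijections (suc k) (suc d) m z<s
  open Decomposition (suc d) m
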